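{- Let $R\to R_0$ be a surjection of commutative rings such that $3$ and $4$ are nonzero in $R_0$, and such that the induced map $\mathrm{SL}_2(R)\to\mathrm{SL}_2(R_0)$ is surjective. Let $U$ be a free rank-$2$ $R$-module with a non-degenerate symplectic pairing and an $R$-linear involution $C$ of determinant $-1$; let $U_0=U\otimes_R R_0$ with the induced pairing and induced involution $C_0$. Let $G_0\subset\mathrm{SL}(U_0)$ be a subgroup containing $-1$ and stable under conjugation by $C_0$, and let $G$ be its inverse image in $\mathrm{SL}(U)$. Then the graphs $\Xi_G$ (for $(R,U,C,G)$) and $\Xi_{G_0}$ (for $(R_0,U_0,C_0,G_0)$) are isomorphic.
   Context: Construction of $\Xi_G$: Let $R$ be a commutative ring, $U$ a free rank-2 $R$-module with a non-degenerate alternating bilinear pairing $\langle\,,\rangle$, $C$ an $R$-linear involution of $U$ of determinant $-1$, and $G\subset\mathrm{SL}(U)$ a subgroup containing $-1$ with $g^c:=CgC^{ -1}\in G$ for all $g\in G$. An element $g\in G$ is admissible if $g^c=g^{ -1}$. A basis vector is an element of $U$ generating a direct summand of $U$ free of rank one (i.e. an element of some basis of $U$). A parabolic vertex is an element of $U/\{\pm1\}$ represented by a basis vector $x$ with $Cgx=x$ for some admissible $g\in G$. Let $\mathcal{T}$ be the set of triples $[x,y;z]$ of basis vectors with $\langle x,z\rangle=\langle z,y\rangle=1$ and $x+y=wz$ for some $w\in\{1,2\}$ (the weight); the complementary weight is $w'=3-w$. Let $\rho[x,y;z]=[z,z-w'x;y]$, a permutation of $\mathcal{T}$ commuting with $G$.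 A triple satisfies condition (c) if there is $g\in G$ with $Cgu-u=w'\langle u,x\rangle y$ and $Cgu+u=w'\langle u,y\rangle x$ for all $u\in U$; (c) holds for $[x,y;z]$ iff it holds for $\rho^2[x,y;z]$. A geodesic is an element of $\mathcal{T}/\langle\rho^2\rangle$ satisfying (c); its weight is well defined. Two geodesics intersect if the involution induced by $\rho$ on $\mathcal{T}/\langle\rho^2\rangle$ maps one to the other. An elliptic vertex is an unordered pair of intersecting geodesics, said to be contained in each of them. The graph $\widetilde{\Xi}$ has as vertices the parabolic and elliptic vertices; a geodesic $[x,y;z]$ containing no elliptic vertex contributes an edge between $\pm x$ and $\pm y$; a geodesic $[x,y;z]$ containing an elliptic vertex $p$ contributes an edge between $\pm x$ and $p$ and an edge between $p$ and $\pm y$; edges carry the weight of their geodesic. $G$ acts on $\widetilde{\Xi}$ and $\Xi_G$ is the quotient graph: vertices are $G$-orbits of vertices (typed parabolic/elliptic), edges are $G$-orbits of edges (weighted), with induced incidence. -}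

module Defs where

open import Level using (Level; _⊔_) renaming (suc to lsuc)
open import Algebra.Bundles using (CommutativeRing)
open import Algebra.Morphism.Structures using (IsRingHomomorphism)
open import Data.Product using (Σ; ∃; _×_; _,_; proj₁; proj₂)
open import Data.Sum using (_⊎_; inj₁; inj₂)
open import Data.Nat using (ℕ; zero; suc)
open import Data.Bool using (Bool; true; false; not)
open import Data.Empty.Polymorphic using (⊥)
open import Function.Bundles using (_⇔_)
open import Relation.Nullary using (¬_)
open import Relation.Binary.PropositionalEquality using (_≡_)

iter : ∀ {a} {A : Set a} → (A → A) → ℕ → A → A
iter h zero x = x
iter h (suc n) x = h (iter h n x)

data Wt : Set where
  w1 w2 : Wt

-- complementary weight w' = 3 - w
comp : Wt → Wt
comp w1 = w2
comp w2 = w1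

data VKind : Set where
  parabolic elliptic : VKind

-- 2×2 matrices (endomorphisms of the free module U = R² in the standard basis)
record Mat {c} (A : Set c) : Set c where
  constructor mat
  field
    m11 m12 m21 m22 : A

mapMat : ∀ {c d} {A : Set c} {B : Set d} → (A → B) → Mat A → Mat B
mapMat f (mat a b c d) = mat (f a) (f b) (f c) (f d)

-- A (multi)graph with typed vertices and weighted edges, presented by
-- representatives together with the relation "represent the same vertex /
-- edge" (quotients are not available), and an incidence relation.

record QGraph (a : Level) : Set (lsuc a) where
  field
    V      : Set a
    _≈V_   : V → V → Set a
    kind   : V → VKind
    E      : Set a
    _≈E_   : E → E → Set a
    weight : E → Wt
    Inc    : E → V → Set a

record _≅_ {a b} (Γ : QGraph a) (Δ : QGraph b) : Set (a ⊔ b) where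
  open QGraph
  field
    fV      : V Γ → V Δ
    fV-cong : ∀ {u v} → _≈V_ Γ u v → _≈V_ Δ (fV u) (fV v)
    fV-inj  : ∀ {u v} → _≈V_ Δ (fV u) (fV v) → _≈V_ Γ u v
    fV-surj : ∀ v → Σ (V Γ) λ u → _≈V_ Δ (fV u) v
    fV-kind : ∀ v → kind Δ (fV v) ≡ kind Γ v
    fE      : E Γ → E Δ
    fE-cong : ∀ {e e'} → _≈E_ Γ e e' → _≈E_ Δ (fE e) (fE e')
    fE-inj  : ∀ {e e'} → _≈E_ Δ (fE e) (fE e') → _≈E_ Γ e e'
    fE-surj : ∀ e → Σ (E Γ) λ e' → _≈E_ Δ (fE e') e
    fE-wt   : ∀ e → weight Δ (fE e) ≡ weight Γ e
    fInc    : ∀ e v → Inc Γ e v ⇔ Inc Δ (fE e) (fV v)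

module LinAlg {c ℓ} (R : CommutativeRing c ℓ) where
  open CommutativeRing R renaming (Carrier to K)

  _−_ : K → K → K
  x − y = x + (- y)

  two three four : K
  two = 1# + 1#
  three = two + 1#
  four = three + 1#

  U : Set c
  U = K × K

  _≈U_ : U → U → Set ℓ
  (x₁ , x₂) ≈U (y₁ , y₂) = (x₁ ≈ y₁) × (x₂ ≈ y₂)

  negU : U → U
  negU (x₁ , x₂) = (- x₁ , - x₂)

  _+U_ _−U_ : U → U → U
  (x₁ , x₂) +U (y₁ , y₂) = (x₁ + y₁ , x₂ + y₂)
  x −U y = x +U negU y

  _·U_ : K → U → U
  r ·U (x₁ , x₂) = (r * x₁ , r * x₂)

  -- equality in U / {±1}
  _≈±_ : U → U → Set ℓ
  x ≈± y = (x ≈U y) ⊎ (x ≈U negU y)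

  det : U → U → K
  det (x₁ , x₂) (y₁ , y₂) = (x₁ * y₂) − (x₂ * y₁)

  IsUnit : K → Set (c ⊔ ℓ)
  IsUnit r = Σ K λ s → r * s ≈ 1#

  M : Set c
  M = Mat K

  app : M → U → U
  app (mat a b c d) (x₁ , x₂) = (a * x₁ + b * x₂ , c * x₁ + d * x₂)

  _∙_ : M → M → M
  mat a b c d ∙ mat a' b' c' d' =
    mat (a * a' + b * c') (a * b' + b * d') (c * a' + d * c') (c * b' + d * d')

  detM : M → K
  detM (mat a b c d) = (a * d) − (b * c)

  I negI : M
  I = mat 1# 0# 0# 1#
  negI = mat (- 1#) 0# 0# (- 1#)

  _≈M_ : M → M → Set ℓ
  mat a b c d ≈M mat a' b' c' d' = (a ≈ a') × (b ≈ b') × (c ≈ c') × (d ≈ d')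

  wval : Wt → K
  wval w1 = 1#
  wval w2 = two

  record IsSubgroupOfSL {g} (G : M → Set g) : Set (c ⊔ ℓ ⊔ g) where
    field
      resp     : ∀ {A B} → A ≈M B → G A → G B
      ⊆SL      : ∀ {A} → G A → detM A ≈ 1#
      has-I    : G I
      closed-∙ : ∀ {A B} → G A → G B → G (A ∙ B)
      closed-⁻¹ : ∀ {A} → G A → Σ M λ B → G B × ((A ∙ B) ≈M I)

-- The graph Ξ_G attached to (R, U = R², ⟨,⟩, C, G).
-- The non-degenerate alternating pairing on R² is ⟨x,y⟩ = α · det(x,y)
-- with α a unit (every such pairing has this form).

module XiConstruction {c ℓ g} (R : CommutativeRing c ℓ)
  (α : CommutativeRing.Carrier R) (C : Mat (CommutativeRing.Carrier R))
  (G : Mat (CommutativeRing.Carrier R) → Set g) where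
  open CommutativeRing R renaming (Carrier to K)
  open LinAlg R

  ⟨_,_⟩ : U → U → K
  ⟨ x , y ⟩ = α * det x y

  IsBasisVector : U → Set (c ⊔ ℓ)
  IsBasisVector x = Σ U λ y → IsUnit (det x y)

  -- g^c = C g C⁻¹ (C is an involution, so C⁻¹ = C)
  _ᶜ : M → M
  h ᶜ = C ∙ (h ∙ C)

  -- admissible: g ∈ G and g^c = g⁻¹, i.e. g^c g = 1
  Admissible : M → Set (ℓ ⊔ g)
  Admissible h = G h × (((h ᶜ) ∙ h) ≈M I)

  IsParabolic : U → Set (c ⊔ ℓ ⊔ g)
  IsParabolic x = IsBasisVector x × Σ M λ h → Admissible h × (app C (app h x) ≈U x)

  record Tri : Set c where
    constructor tri
    field
      x y z : U
      w : Wt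
  open Tri

  InT : Tri → Set (c ⊔ ℓ)
  InT t = IsBasisVector (x t) × IsBasisVector (y t) × IsBasisVector (z t)
        × (⟨ x t , z t ⟩ ≈ 1#) × (⟨ z t , y t ⟩ ≈ 1#)
        × ((x t +U y t) ≈U (wval (w t) ·U z t))

  ρ : Tri → Tri
  ρ (tri x y z w) = tri z (z −U (wval (comp w) ·U x)) y (comp w)

  ρ² : Tri → Tri
  ρ² t = ρ (ρ t)

  TEq : Tri → Tri → Set ℓ
  TEq t s = (x t ≈U x s) × (y t ≈U y s) × (z t ≈U z s) × (w t ≡ w s)

  -- same ⟨ρ²⟩-orbit (ρ has finite order, so ℕ-powers suffice)
  Orb : Tri → Tri → Set ℓ
  Orb t s = Σ ℕ λ n → TEq (iter ρ² n t) s

  CondC : Tri → Set (c ⊔ ℓ ⊔ g)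
  CondC t = Σ M λ h → G h × (∀ u →
      ((app C (app h u) −U u) ≈U ((wval (comp (w t)) * ⟨ u , x t ⟩) ·U y t))
    × ((app C (app h u) +U u) ≈U ((wval (comp (w t)) * ⟨ u , y t ⟩) ·U x t)))

  -- geodesics (represented by triples; equal iff same ⟨ρ²⟩-orbit)
  record Geo : Set (c ⊔ ℓ ⊔ g) where
    constructor geo
    field
      tr  : Tri
      inT : InT tr
      cc  : CondC tr
  open Geo

  Intersect : Geo → Geo → Set ℓ
  Intersect γ δ = Orb (ρ (tr γ)) (tr δ)

  -- elliptic vertices: unordered pairs of intersecting geodesics
  record Ell : Set (c ⊔ ℓ ⊔ g) where
    constructor ell
    field
      γ₁ γ₂ : Geo
      meet  : Intersect γ₁ γ₂
  open Ell

  actT : M → Tri → Tri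
  actT h (tri x y z w) = tri (app h x) (app h y) (app h z) w

  PEq : M → Ell → Ell → Set ℓ
  PEq h p q = (Orb (actT h (tr (γ₁ p))) (tr (γ₁ q)) × Orb (actT h (tr (γ₂ p))) (tr (γ₂ q)))
            ⊎ (Orb (actT h (tr (γ₁ p))) (tr (γ₂ q)) × Orb (actT h (tr (γ₂ p))) (tr (γ₁ q)))

  Contains : Geo → Ell → Set ℓ
  Contains γ p = Orb (tr (γ₁ p)) (tr γ) ⊎ Orb (tr (γ₂ p)) (tr γ)

  VRep : Set (c ⊔ ℓ ⊔ g)
  VRep = (Σ U IsParabolic) ⊎ Ell

  -- edges of Ξ̃: a geodesic with no elliptic vertex gives one edge;
  -- a geodesic γ = [x,y;z] containing the elliptic vertex p gives two edges,
  -- the one towards ±x (side = true) and the one towards ±y (side = false).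
  record HalfEdge : Set (c ⊔ ℓ ⊔ g) where
    constructor half
    field
      γ    : Geo
      p    : Ell
      γ∋p  : Contains γ p
      side : Bool
  open HalfEdge

  ERep : Set (c ⊔ ℓ ⊔ g)
  ERep = (Σ Geo λ γ → ¬ (Σ Ell λ p → Contains γ p)) ⊎ HalfEdge

  endpt : Tri → Bool → U
  endpt t true  = x t
  endpt t false = y t

  IncT : ERep → VRep → Set ℓ
  IncT (inj₁ (γ , _)) (inj₁ (u , _)) = (u ≈± x (tr γ)) ⊎ (u ≈± y (tr γ))
  IncT (inj₁ _)       (inj₂ _)       = ⊥
  IncT (inj₂ e)       (inj₁ (u , _)) = u ≈± endpt (tr (γ e)) (side e)
  IncT (inj₂ e)       (inj₂ q)       = PEq I (p e) q

  VRel : VRep → VRep → Set (c ⊔ ℓ ⊔ g)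
  VRel (inj₁ (u , _)) (inj₁ (v , _)) = Σ M λ h → G h × (app h u ≈± v)
  VRel (inj₁ _)       (inj₂ _)       = ⊥
  VRel (inj₂ _)       (inj₁ _)       = ⊥
  VRel (inj₂ p)       (inj₂ q)       = Σ M λ h → G h × PEq h p q

  ERel : ERep → ERep → Set (c ⊔ ℓ ⊔ g)
  ERel (inj₁ (γ , _)) (inj₁ (δ , _)) = Σ M λ h → G h × Orb (actT h (tr γ)) (tr δ)
  ERel (inj₁ _)       (inj₂ _)       = ⊥
  ERel (inj₂ _)       (inj₁ _)       = ⊥
  ERel (inj₂ e)       (inj₂ f)       = Σ M λ h → G h ×
    ((Σ ℕ λ n → TEq (iter ρ² n (actT h (tr (γ e)))) (tr (γ f)) × (iter not n (side e) ≡ side f))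
     × PEq h (p e) (p f))

  kindOf : VRep → VKind
  kindOf (inj₁ _) = parabolic
  kindOf (inj₂ _) = elliptic

  weightOf : ERep → Wt
  weightOf (inj₁ (γ , _)) = w (tr γ)
  weightOf (inj₂ e)       = w (tr (γ e))

  Ξ : QGraph (c ⊔ ℓ ⊔ g)
  Ξ = record
    { V      = VRep
    ; _≈V_   = VRel
    ; kind   = kindOf
    ; E      = ERep
    ; _≈E_   = ERel
    ; weight = weightOf
    ; Inc    = λ e v → Σ ERep λ e' → Σ VRep λ v' → ERel e e' × VRel v v' × IncT e' v'
    }

XiGraph : ∀ {c ℓ g} (R : CommutativeRing c ℓ) (α : CommutativeRing.Carrier R)
     (C : Mat (CommutativeRing.Carrier R)) (G : Mat (CommutativeRing.Carrier R) → Set g)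
     → QGraph (c ⊔ ℓ ⊔ g)
XiGraph R α C G = XiConstruction.Ξ R α C G

record IsRingSurjection {c₁ ℓ₁ c₂ ℓ₂} (R : CommutativeRing c₁ ℓ₁) (R₀ : CommutativeRing c₂ ℓ₂)
  (f : CommutativeRing.Carrier R → CommutativeRing.Carrier R₀) : Set (c₁ ⊔ ℓ₁ ⊔ c₂ ⊔ ℓ₂) where
  field
    isHom : IsRingHomomorphism (CommutativeRing.rawRing R) (CommutativeRing.rawRing R₀) f
    surj  : ∀ y → Σ (CommutativeRing.Carrier R) λ x → CommutativeRing._≈_ R₀ (f x) y

SL₂-surjective : ∀ {c₁ ℓ₁ c₂ ℓ₂} (R : CommutativeRing c₁ ℓ₁) (R₀ : CommutativeRing c₂ ℓ₂)
  (f : CommutativeRing.Carrier R → CommutativeRing.Carrier R₀) → Set (c₁ ⊔ ℓ₁ ⊔ c₂ ⊔ ℓ₂)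
SL₂-surjective R R₀ f =
  ∀ B → LinAlg.detM R₀ B ≈₀ CommutativeRing.1# R₀ →
    Σ (LinAlg.M R) λ A → (LinAlg.detM R A ≈ CommutativeRing.1# R) × LinAlg._≈M_ R₀ (mapMat f A) B
  where
    _≈₀_ = CommutativeRing._≈_ R₀
    _≈_  = CommutativeRing._≈_ R

preimage : ∀ {c₁ ℓ₁ c₂ ℓ₂ g} (R : CommutativeRing c₁ ℓ₁) (R₀ : CommutativeRing c₂ ℓ₂)
  (f : CommutativeRing.Carrier R → CommutativeRing.Carrier R₀)
  (G₀ : LinAlg.M R₀ → Set g) → LinAlg.M R → Set (ℓ₁ ⊔ g)
preimage R R₀ f G₀ A = CommutativeRing._≈_ R (LinAlg.detM R A) (CommutativeRing.1# R) × G₀ (mapMat f A)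

-- Reduction along f sends basis vectors, the triples of 𝒯, ρ, condition (c), admissible
-- elements and the G-action to their counterparts over R₀, so it induces a map Ξ_G → Ξ_{G₀}.
-- Everything also lifts. Unimodular pairs lift by SL₂-surjectivity, hence so do basis vectors
-- and triples, and the kernel of SL₂(R) → SL₂(R₀), which lies in G, acts transitively on the
-- lifts of a unimodular pair; so G-orbits upstairs match G₀-orbits downstairs. Condition (c)
-- for [x , y ; z] pins its witness down to C composed with the reflection u ↦ u + w′⟨u , x⟩ y,
-- which lies in G exactly when its reduction lies in G₀. A parabolic witness h₀ fixing φ u
-- lifts to C ∘ M′ with M′ the involution fixing u and sending a partner a of u to c u − a.

module Submission where

open import Defs
open import Algebra.Bundles using (CommutativeRing)
open import Relation.Nullary using (¬_)
open import Algebra.Morphism.Structures using (module IsRingHomomorphism)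
open import Algebra.Solver.Ring.AlmostCommutativeRing using (_-Raw-AlmostCommutative⟶_; fromCommutativeRing)
open import Data.Bool.Base using (true; false; not)
import Data.Bool.Properties as Bool
open import Data.Integer.Base as ℤ using (ℤ; +_; -[1+_]; _⊖_)
import Data.Integer.Properties as ℤ
open import Data.Maybe.Base using (Maybe; just; nothing)
open import Data.Nat.Base as ℕ using (ℕ; zero; suc)
import Data.Nat.Properties as ℕ
open import Data.Product.Base using (Σ; _×_; _,_; proj₁; proj₂)
open import Data.Sign.Base as Sign using (Sign)
open import Data.Sum.Base using (inj₁; inj₂)
open import Function.Bundles using (_⇔_; mk⇔)
import Level
open import Relation.Binary.Bundles using (Setoid)
open import Relation.Binary.PropositionalEquality.Core as ≡ using (_≡_)
import Relation.Binary.Reasoning.Setoid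
open import Relation.Nullary.Decidable.Core using (yes; no)

-- The standard library's ring solver needs coefficients with decidable equality, so we
-- instantiate it with integer coefficients. Using the optimised natural multiple makes
-- con (+ 1) and con (+ 2) evaluate to 1# and 1# + 1# on the nose.
module IntegerCoefficients {c ℓ} (R : CommutativeRing c ℓ) where
  open CommutativeRing R
  open import Algebra.Properties.Ring ring
    using (-‿distribˡ-*; -‿distribʳ-*; -‿involutive; -0#≈0#; -‿anti-homo-+)
  open import Algebra.Properties.Semiring.Mult.TCOptimised semiring using (×-homo-+; ×1-homo-*) renaming (_×_ to _·ℕ_)
  open import Relation.Binary.Reasoning.Setoid setoid

  ⟦_⟧ℤ : ℤ → Carrier
  ⟦ + n ⟧ℤ      = n ·ℕ 1#
  ⟦ -[1+ n ] ⟧ℤ = - (suc n ·ℕ 1#)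

  private
    signed : Sign → Carrier → Carrier
    signed Sign.+ x = x
    signed Sign.- x = - x

    x-0#≈x : ∀ x → x - 0# ≈ x
    x-0#≈x x = trans (+-congˡ -0#≈0#) (+-identityʳ x)

    cancel-1# : ∀ a b → (1# + a) - (1# + b) ≈ a - b
    cancel-1# a b = begin
      (1# + a) - (1# + b)      ≈⟨ +-congˡ (-‿anti-homo-+ 1# b) ⟩
      (1# + a) + (- b - 1#)    ≈⟨ +-congʳ (+-comm 1# a) ⟩
      (a + 1#) + (- b - 1#)    ≈⟨ +-assoc a 1# _ ⟩
      a + (1# + (- b - 1#))    ≈⟨ +-congˡ (+-congˡ (+-comm (- b) (- 1#))) ⟩
      a + (1# + (- 1# - b))    ≈⟨ +-congˡ (+-assoc 1# (- 1#) (- b)) ⟨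
      a + ((1# - 1#) - b)      ≈⟨ +-congˡ (+-congʳ (-‿inverseʳ 1#)) ⟩
      a + (0# - b)             ≈⟨ +-congˡ (+-identityˡ (- b)) ⟩
      a - b                    ∎

    ⊖-homo : ∀ m n → ⟦ m ⊖ n ⟧ℤ ≈ m ·ℕ 1# - n ·ℕ 1#
    ⊖-homo zero    zero    = sym (x-0#≈x 0#)
    ⊖-homo zero    (suc n) = sym (+-identityˡ _)
    ⊖-homo (suc m) zero    = sym (x-0#≈x _)
    ⊖-homo (suc m) (suc n) = begin
      ⟦ suc m ⊖ suc n ⟧ℤ              ≡⟨ ≡.cong ⟦_⟧ℤ (ℤ.[1+m]⊖[1+n]≡m⊖n m n) ⟩
      ⟦ m ⊖ n ⟧ℤ                      ≈⟨ ⊖-homo m n ⟩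
      m ·ℕ 1# - n ·ℕ 1#               ≈⟨ cancel-1# _ _ ⟨
      (1# + m ·ℕ 1#) - (1# + n ·ℕ 1#) ≈⟨ +-cong (×-homo-+ 1# 1 m) (-‿cong (×-homo-+ 1# 1 n)) ⟨
      suc m ·ℕ 1# - suc n ·ℕ 1#       ∎

    +-homo : ∀ i j → ⟦ i ℤ.+ j ⟧ℤ ≈ ⟦ i ⟧ℤ + ⟦ j ⟧ℤ
    +-homo (+ m)    (+ n)    = ×-homo-+ 1# m n
    +-homo (+ m)    -[1+ n ] = ⊖-homo m (suc n)
    +-homo -[1+ m ] (+ n)    = trans (⊖-homo n (suc m)) (+-comm _ _)
    +-homo -[1+ m ] -[1+ n ] = begin
      - (suc (suc (m ℕ.+ n)) ·ℕ 1#)   ≡⟨ ≡.cong (λ k → - (k ·ℕ 1#)) (ℕ.+-suc (suc m) n) ⟨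
      - ((suc m ℕ.+ suc n) ·ℕ 1#)     ≈⟨ -‿cong (×-homo-+ 1# (suc m) (suc n)) ⟩
      - (suc m ·ℕ 1# + suc n ·ℕ 1#)   ≈⟨ -‿anti-homo-+ _ _ ⟩
      - (suc n ·ℕ 1#) - suc m ·ℕ 1#   ≈⟨ +-comm _ _ ⟩
      - (suc m ·ℕ 1#) - suc n ·ℕ 1#   ∎

    ◃-homo : ∀ s n → ⟦ s ℤ.◃ n ⟧ℤ ≈ signed s (n ·ℕ 1#)
    ◃-homo Sign.+ zero    = refl
    ◃-homo Sign.- zero    = sym -0#≈0#
    ◃-homo Sign.+ (suc n) = refl
    ◃-homo Sign.- (suc n) = refl

    ⟦⟧ℤ-signed : ∀ i → ⟦ i ⟧ℤ ≈ signed (ℤ.sign i) (ℤ.∣ i ∣ ·ℕ 1#)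
    ⟦⟧ℤ-signed (+ n)    = refl
    ⟦⟧ℤ-signed -[1+ n ] = refl

    signed-cong : ∀ s {x y} → x ≈ y → signed s x ≈ signed s y
    signed-cong Sign.+ p = p
    signed-cong Sign.- p = -‿cong p

    signed-* : ∀ s t x y → signed (s Sign.* t) (x * y) ≈ signed s x * signed t y
    signed-* Sign.+ Sign.+ x y = refl
    signed-* Sign.+ Sign.- x y = -‿distribʳ-* x y
    signed-* Sign.- Sign.+ x y = -‿distribˡ-* x y
    signed-* Sign.- Sign.- x y = begin
      x * y         ≈⟨ -‿involutive _ ⟨
      - - (x * y)   ≈⟨ -‿cong (-‿distribʳ-* x y) ⟩
      - (x * - y)   ≈⟨ -‿distribˡ-* x (- y) ⟩
      - x * - y     ∎

    *-homo : ∀ i j → ⟦ i ℤ.* j ⟧ℤ ≈ ⟦ i ⟧ℤ * ⟦ j ⟧ℤ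
    *-homo i j = begin
      ⟦ s ℤ.◃ (ℤ.∣ i ∣ ℕ.* ℤ.∣ j ∣) ⟧ℤ            ≈⟨ ◃-homo s (ℤ.∣ i ∣ ℕ.* ℤ.∣ j ∣) ⟩
      signed s ((ℤ.∣ i ∣ ℕ.* ℤ.∣ j ∣) ·ℕ 1#)      ≈⟨ signed-cong s (×1-homo-* ℤ.∣ i ∣ ℤ.∣ j ∣) ⟩
      signed s (ℤ.∣ i ∣ ·ℕ 1# * ℤ.∣ j ∣ ·ℕ 1#)    ≈⟨ signed-* (ℤ.sign i) (ℤ.sign j) _ _ ⟩
      signed (ℤ.sign i) (ℤ.∣ i ∣ ·ℕ 1#) * signed (ℤ.sign j) (ℤ.∣ j ∣ ·ℕ 1#)
                                                ≈⟨ *-cong (⟦⟧ℤ-signed i) (⟦⟧ℤ-signed j) ⟨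
      ⟦ i ⟧ℤ * ⟦ j ⟧ℤ                            ∎
      where s = ℤ.sign i Sign.* ℤ.sign j

    -‿homo : ∀ i → ⟦ ℤ.- i ⟧ℤ ≈ - ⟦ i ⟧ℤ
    -‿homo -[1+ n ]    = sym (-‿involutive _)
    -‿homo (+ zero)    = sym -0#≈0#
    -‿homo (+ (suc n)) = refl

    homomorphism : ℤ.+-*-rawRing -Raw-AlmostCommutative⟶ fromCommutativeRing R
    homomorphism = record
      { ⟦_⟧ = ⟦_⟧ℤ ; +-homo = +-homo ; *-homo = *-homo ; -‿homo = -‿homo
      ; 0-homo = refl ; 1-homo = refl }

    _coeff≟_ : ∀ i j → Maybe (⟦ i ⟧ℤ ≈ ⟦ j ⟧ℤ)
    i coeff≟ j with i ℤ.≟ j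
    ... | yes ≡.refl = just refl
    ... | no _       = nothing

  open import Algebra.Solver.Ring ℤ.+-*-rawRing (fromCommutativeRing R) homomorphism _coeff≟_ public

module Matrices {c ℓ} (R : CommutativeRing c ℓ) where
  open CommutativeRing R renaming (Carrier to K)
  open LinAlg R public
  open IntegerCoefficients R using (solve; _:=_; _:+_; _:*_; _:-_; :-_; con)
  open import Algebra.Properties.Ring ring using (-‿involutive)

  ≈U-refl : ∀ {u} → u ≈U u
  ≈U-refl = refl , refl

  ≈U-sym : ∀ {u v} → u ≈U v → v ≈U u
  ≈U-sym (p , q) = sym p , sym q

  ≈U-trans : ∀ {u v w} → u ≈U v → v ≈U w → u ≈U w
  ≈U-trans (p , q) (p′ , q′) = trans p p′ , trans q q′

  U-setoid : Setoid c ℓ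
  U-setoid = record
    { Carrier = U ; _≈_ = _≈U_
    ; isEquivalence = record { refl = ≈U-refl ; sym = ≈U-sym ; trans = ≈U-trans } }

  module ≈U-Reasoning = Relation.Binary.Reasoning.Setoid U-setoid

  ≈M-refl : ∀ {A} → A ≈M A
  ≈M-refl = refl , refl , refl , refl

  ≈M-sym : ∀ {A B} → A ≈M B → B ≈M A
  ≈M-sym (p , q , r , s) = sym p , sym q , sym r , sym s

  ≈M-trans : ∀ {A B C} → A ≈M B → B ≈M C → A ≈M C
  ≈M-trans (p , q , r , s) (p′ , q′ , r′ , s′) = trans p p′ , trans q q′ , trans r r′ , trans s s′

  M-setoid : Setoid c ℓ
  M-setoid = record
    { Carrier = M ; _≈_ = _≈M_
    ; isEquivalence = record { refl = ≈M-refl ; sym = ≈M-sym ; trans = ≈M-trans } }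

  module ≈M-Reasoning = Relation.Binary.Reasoning.Setoid M-setoid

  negU-cong : ∀ {u v} → u ≈U v → negU u ≈U negU v
  negU-cong (p , q) = -‿cong p , -‿cong q

  +U-cong : ∀ {u v u′ v′} → u ≈U u′ → v ≈U v′ → (u +U v) ≈U (u′ +U v′)
  +U-cong (p , q) (p′ , q′) = +-cong p p′ , +-cong q q′

  −U-cong : ∀ {u v u′ v′} → u ≈U u′ → v ≈U v′ → (u −U v) ≈U (u′ −U v′)
  −U-cong p q = +U-cong p (negU-cong q)

  ·U-cong : ∀ {r s u v} → r ≈ s → u ≈U v → (r ·U u) ≈U (s ·U v)
  ·U-cong r (p , q) = *-cong r p , *-cong r q

  negU-involutive : ∀ u → negU (negU u) ≈U u
  negU-involutive (a , b) = -‿involutive a , -‿involutive b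

  negU-+ : ∀ u v → negU (u +U v) ≈U (negU u −U v)
  negU-+ (u₁ , u₂) (v₁ , v₂) = e u₁ v₁ , e u₂ v₂
    where
    e : ∀ a b → - (a + b) ≈ - a - b
    e = solve 2 (λ a b → :- (a :+ b) := :- a :- b) refl

  negU-− : ∀ u v → negU (u −U v) ≈U (negU u +U v)
  negU-− (u₁ , u₂) (v₁ , v₂) = e u₁ v₁ , e u₂ v₂
    where
    e : ∀ a b → - (a - b) ≈ - a + b
    e = solve 2 (λ a b → :- (a :- b) := :- a :+ b) refl

  negU-· : ∀ r u → negU (r ·U u) ≈U (r ·U negU u)
  negU-· r (u₁ , u₂) = e u₁ , e u₂
    where
    e : ∀ a → - (r * a) ≈ r * - a
    e a = solve 2 (λ r a → :- (r :* a) := r :* :- a) refl r a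

  +U-comm : ∀ u v → (u +U v) ≈U (v +U u)
  +U-comm (u₁ , u₂) (v₁ , v₂) = +-comm u₁ v₁ , +-comm u₂ v₂

  ·U-assoc : ∀ r s u → (r ·U (s ·U u)) ≈U ((r * s) ·U u)
  ·U-assoc r s (x , y) = sym (*-assoc r s x) , sym (*-assoc r s y)

  ·U-identityˡ : ∀ u → (1# ·U u) ≈U u
  ·U-identityˡ (x , y) = *-identityˡ x , *-identityˡ y

  ·U-unit : ∀ {d s} u → s * d ≈ 1# → (s ·U (d ·U u)) ≈U u
  ·U-unit {d} {s} u sd = ≈U-trans (·U-assoc s d u) (≈U-trans (·U-cong sd ≈U-refl) (·U-identityˡ u))

  ·U-negˡ : ∀ r u → ((- r) ·U u) ≈U negU (r ·U u)
  ·U-negˡ r (u₁ , u₂) = e u₁ , e u₂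
    where
    e : ∀ a → - r * a ≈ - (r * a)
    e a = solve 2 (λ r a → :- r :* a := :- (r :* a)) refl r a

  ·U-neg1 : ∀ u → ((- 1#) ·U u) ≈U negU u
  ·U-neg1 (u₁ , u₂) = e u₁ , e u₂
    where
    e : ∀ a → - 1# * a ≈ - a
    e = solve 1 (λ a → :- con (+ 1) :* a := :- a) refl

  −U⇒+U : ∀ {u v r} → (v −U u) ≈U r → v ≈U (u +U r)
  −U⇒+U {u₁ , u₂} {v₁ , v₂} (p , q) = trans (e u₁ v₁) (+-congˡ p) , trans (e u₂ v₂) (+-congˡ q)
    where
    e : ∀ u v → v ≈ u + (v - u)
    e = solve 2 (λ u v → v := u :+ (v :- u)) refl

  y≈v−x : ∀ {x y v} → (x +U y) ≈U v → y ≈U (v −U x)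
  y≈v−x {x₁ , x₂} {y₁ , y₂} (p , q) = trans (cancel x₁ y₁) (+-congʳ p) , trans (cancel x₂ y₂) (+-congʳ q)
    where
    cancel : ∀ x y → y ≈ (x + y) - x
    cancel = solve 2 (λ x y → y := (x :+ y) :- x) refl

  y−v≈-x : ∀ {x y v} → (x +U y) ≈U v → (y −U v) ≈U negU x
  y−v≈-x {x₁ , x₂} {y₁ , y₂} (p , q) = trans (+-congˡ (-‿cong (sym p))) (cancel x₁ y₁) , trans (+-congˡ (-‿cong (sym q))) (cancel x₂ y₂)
    where
    cancel : ∀ x y → y - (x + y) ≈ - x
    cancel = solve 2 (λ x y → y :- (x :+ y) := :- x) refl

  x+[v−x]≈v : ∀ x v → (x +U (v −U x)) ≈U v
  x+[v−x]≈v (x₁ , x₂) (v₁ , v₂) = cancel x₁ v₁ , cancel x₂ v₂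
    where
    cancel : ∀ x v → x + (v - x) ≈ v
    cancel = solve 2 (λ x v → x :+ (v :- x) := v) refl

  [u+v]−u≈v : ∀ u v → ((u +U v) −U u) ≈U v
  [u+v]−u≈v (u₁ , u₂) (v₁ , v₂) = e u₁ v₁ , e u₂ v₂
    where
    e : ∀ u v → (u + v) - u ≈ v
    e = solve 2 (λ u v → (u :+ v) :- u := v) refl

  v−[v−a]≈a : ∀ v a → (v −U (v −U a)) ≈U a
  v−[v−a]≈a (v₁ , v₂) (a₁ , a₂) = e v₁ a₁ , e v₂ a₂
    where
    e : ∀ v a → v - (v - a) ≈ a
    e = solve 2 (λ v a → v :- (v :- a) := a) refl

  det-cong : ∀ {u v u′ v′} → u ≈U u′ → v ≈U v′ → det u v ≈ det u′ v′
  det-cong (p , q) (p′ , q′) = +-cong (*-cong p q′) (-‿cong (*-cong q p′))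

  det-antisym : ∀ u v → det v u ≈ - det u v
  det-antisym (u₁ , u₂) (v₁ , v₂) = solve 4 (λ u₁ u₂ v₁ v₂ → v₁ :* u₂ :- v₂ :* u₁ := :- (u₁ :* v₂ :- u₂ :* v₁)) refl u₁ u₂ v₁ v₂

  det-negU : ∀ u v → det (negU u) (negU v) ≈ det u v
  det-negU (u₁ , u₂) (v₁ , v₂) = solve 4 (λ a b c d → :- a :* :- d :- :- b :* :- c := a :* d :- b :* c) refl u₁ u₂ v₁ v₂

  det-negUʳ : ∀ u v → det u (negU v) ≈ - det u v
  det-negUʳ (u₁ , u₂) (v₁ , v₂) = solve 4 (λ u₁ u₂ v₁ v₂ → u₁ :* :- v₂ :- u₂ :* :- v₁ := :- (u₁ :* v₂ :- u₂ :* v₁)) refl u₁ u₂ v₁ v₂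

  det-·ʳ : ∀ r u v → det u (r ·U v) ≈ r * det u v
  det-·ʳ r (u₁ , u₂) (v₁ , v₂) =
    solve 5 (λ r u₁ u₂ v₁ v₂ → u₁ :* (r :* v₂) :- u₂ :* (r :* v₁) := r :* (u₁ :* v₂ :- u₂ :* v₁)) refl r u₁ u₂ v₁ v₂

  det-+·ʳ : ∀ r u v → det u (v +U (r ·U u)) ≈ det u v
  det-+·ʳ r (u₁ , u₂) (v₁ , v₂) =
    solve 5 (λ r u₁ u₂ v₁ v₂ → u₁ :* (v₂ :+ r :* u₂) :- u₂ :* (v₁ :+ r :* u₁) := u₁ :* v₂ :- u₂ :* v₁) refl r u₁ u₂ v₁ v₂

  det-u[ru−a] : ∀ r u a → det u ((r ·U u) −U a) ≈ - det u a
  det-u[ru−a] r (u₁ , u₂) (a₁ , a₂) =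
    solve 5 (λ r u₁ u₂ a₁ a₂ → u₁ :* (r :* u₂ :- a₂) :- u₂ :* (r :* u₁ :- a₁) := :- (u₁ :* a₂ :- u₂ :* a₁)) refl r u₁ u₂ a₁ a₂

  cramer : ∀ u v w → (det u v ·U w) ≈U ((det w v ·U u) +U (det u w ·U v))
  cramer (x₁ , x₂) (y₁ , y₂) (w₁ , w₂) =
    solve 6 (λ x₁ x₂ y₁ y₂ w₁ w₂ → (x₁ :* y₂ :- x₂ :* y₁) :* w₁
                                   := (w₁ :* y₂ :- w₂ :* y₁) :* x₁ :+ (x₁ :* w₂ :- x₂ :* w₁) :* y₁)
            refl x₁ x₂ y₁ y₂ w₁ w₂ ,
    solve 6 (λ x₁ x₂ y₁ y₂ w₁ w₂ → (x₁ :* y₂ :- x₂ :* y₁) :* w₂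
                                   := (w₁ :* y₂ :- w₂ :* y₁) :* x₂ :+ (x₁ :* w₂ :- x₂ :* w₁) :* y₂)
            refl x₁ x₂ y₁ y₂ w₁ w₂

  app-cong : ∀ {A B u v} → A ≈M B → u ≈U v → app A u ≈U app B v
  app-cong (p , q , r , s) (x , y) = +-cong (*-cong p x) (*-cong q y) , +-cong (*-cong r x) (*-cong s y)

  app-congʳ : ∀ A {u v} → u ≈U v → app A u ≈U app A v
  app-congʳ A = app-cong ≈M-refl

  ∙-cong : ∀ {A B A′ B′} → A ≈M A′ → B ≈M B′ → (A ∙ B) ≈M (A′ ∙ B′)
  ∙-cong (p , q , r , s) (p′ , q′ , r′ , s′) =
    +-cong (*-cong p p′) (*-cong q r′) , +-cong (*-cong p q′) (*-cong q s′) ,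
    +-cong (*-cong r p′) (*-cong s r′) , +-cong (*-cong r q′) (*-cong s s′)

  app-+ : ∀ A u v → app A (u +U v) ≈U (app A u +U app A v)
  app-+ (mat a b c d) (x , y) (x′ , y′) = row a b , row c d
    where
    row : ∀ a b → a * (x + x′) + b * (y + y′) ≈ (a * x + b * y) + (a * x′ + b * y′)
    row a b = solve 6 (λ a b x y x′ y′ → a :* (x :+ x′) :+ b :* (y :+ y′) := (a :* x :+ b :* y) :+ (a :* x′ :+ b :* y′)) refl a b x y x′ y′

  app-· : ∀ A r u → app A (r ·U u) ≈U (r ·U app A u)
  app-· (mat a b c d) r (x , y) = row a b , row c d
    where
    row : ∀ a b → a * (r * x) + b * (r * y) ≈ r * (a * x + b * y)
    row a b = solve 5 (λ a b r x y → a :* (r :* x) :+ b :* (r :* y) := r :* (a :* x :+ b :* y)) refl a b r x y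

  app-negU : ∀ A u → app A (negU u) ≈U negU (app A u)
  app-negU (mat a b c d) (x , y) = row a b , row c d
    where
    row : ∀ a b → a * (- x) + b * (- y) ≈ - (a * x + b * y)
    row a b = solve 4 (λ a b x y → a :* (:- x) :+ b :* (:- y) := :- (a :* x :+ b :* y)) refl a b x y

  app-− : ∀ A u v → app A (u −U v) ≈U (app A u −U app A v)
  app-− A u v = ≈U-trans (app-+ A u (negU v)) (+U-cong ≈U-refl (app-negU A v))

  app-∙ : ∀ A B u → app (A ∙ B) u ≈U app A (app B u)
  app-∙ (mat a b c d) (mat a′ b′ c′ d′) (x , y) = row a b , row c d
    where
    row : ∀ a b → (a * a′ + b * c′) * x + (a * b′ + b * d′) * y ≈ a * (a′ * x + b′ * y) + b * (c′ * x + d′ * y)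
    row a b = solve 8 (λ a b a′ b′ c′ d′ x y → (a :* a′ :+ b :* c′) :* x :+ (a :* b′ :+ b :* d′) :* y
                                             := a :* (a′ :* x :+ b′ :* y) :+ b :* (c′ :* x :+ d′ :* y)) refl a b a′ b′ c′ d′ x y

  app-I : ∀ u → app I u ≈U u
  app-I (x , y) = solve 2 (λ x y → con (+ 1) :* x :+ con (+ 0) :* y := x) refl x y ,
                  solve 2 (λ x y → con (+ 0) :* x :+ con (+ 1) :* y := y) refl x y

  app-negI : ∀ u → app negI u ≈U negU u
  app-negI (x , y) = solve 2 (λ x y → :- con (+ 1) :* x :+ con (+ 0) :* y := :- x) refl x y ,
                     solve 2 (λ x y → con (+ 0) :* x :+ :- con (+ 1) :* y := :- y) refl x y

  app-involution : ∀ {A} → (A ∙ A) ≈M I → ∀ v → app A (app A v) ≈U v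
  app-involution {A} A²≈I v = ≈U-trans (≈U-sym (app-∙ A A v)) (≈U-trans (app-cong A²≈I ≈U-refl) (app-I v))

  detM-∙ : ∀ A B → detM (A ∙ B) ≈ detM A * detM B
  detM-∙ (mat a b c d) (mat a′ b′ c′ d′) =
    solve 8 (λ a b c d a′ b′ c′ d′ → (a :* a′ :+ b :* c′) :* (c :* b′ :+ d :* d′) :- (a :* b′ :+ b :* d′) :* (c :* a′ :+ d :* c′)
                                   := (a :* d :- b :* c) :* (a′ :* d′ :- b′ :* c′)) refl a b c d a′ b′ c′ d′

  det-app : ∀ A u v → det (app A u) (app A v) ≈ detM A * det u v
  det-app (mat a b c d) (x , y) (x′ , y′) =
    solve 8 (λ a b c d x y x′ y′ → (a :* x :+ b :* y) :* (c :* x′ :+ d :* y′) :- (c :* x :+ d :* y) :* (a :* x′ :+ b :* y′)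
                                 := (a :* d :- b :* c) :* (x :* y′ :- y :* x′)) refl a b c d x y x′ y′

  detM-negI : detM negI ≈ 1#
  detM-negI = solve 0 (:- con (+ 1) :* :- con (+ 1) :- con (+ 0) :* con (+ 0) := con (+ 1)) refl

  col : U → U → M
  col (x₁ , x₂) (y₁ , y₂) = mat x₁ y₁ x₂ y₂

  adj : M → M
  adj (mat a b c d) = mat d (- b) (- c) a

  _·M_ : K → M → M
  r ·M mat a b c d = mat (r * a) (r * b) (r * c) (r * d)

  column₁ column₂ : M → U
  column₁ (mat a b c d) = a , c
  column₂ (mat a b c d) = b , d

  col-cong : ∀ {u v u′ v′} → u ≈U u′ → v ≈U v′ → col u v ≈M col u′ v′
  col-cong (p , q) (p′ , q′) = p , p′ , q , q′

  detM-col : ∀ u v → detM (col u v) ≈ det u v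
  detM-col (x₁ , x₂) (y₁ , y₂) = +-congˡ (-‿cong (*-comm y₁ x₂))

  ∙-col : ∀ A u v → (A ∙ col u v) ≈M col (app A u) (app A v)
  ∙-col A u v = ≈M-refl

  ∙-identityʳ : ∀ A → (A ∙ I) ≈M A
  ∙-identityʳ (mat a b c d) = row a b , row′ a b , row c d , row′ c d
    where
    row : ∀ a b → a * 1# + b * 0# ≈ a
    row = solve 2 (λ a b → a :* con (+ 1) :+ b :* con (+ 0) := a) refl
    row′ : ∀ a b → a * 0# + b * 1# ≈ b
    row′ = solve 2 (λ a b → a :* con (+ 0) :+ b :* con (+ 1) := b) refl

  adj-∙-∙ : ∀ A B → (adj A ∙ (A ∙ B)) ≈M (detM A ·M B)
  adj-∙-∙ (mat a b c d) (mat a′ b′ c′ d′) = top a′ c′ , top b′ d′ , bottom a′ c′ , bottom b′ d′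
    where
    top : ∀ x y → d * (a * x + b * y) + (- b) * (c * x + d * y) ≈ (a * d - b * c) * x
    top x y = solve 6 (λ a b c d x y → d :* (a :* x :+ b :* y) :+ (:- b) :* (c :* x :+ d :* y) := (a :* d :- b :* c) :* x) refl a b c d x y
    bottom : ∀ x y → (- c) * (a * x + b * y) + a * (c * x + d * y) ≈ (a * d - b * c) * y
    bottom x y = solve 6 (λ a b c d x y → (:- c) :* (a :* x :+ b :* y) :+ a :* (c :* x :+ d :* y) := (a :* d :- b :* c) :* y) refl a b c d x y

  ∙-∙-adj : ∀ A B → ((A ∙ B) ∙ adj B) ≈M (detM B ·M A)
  ∙-∙-adj (mat a b c d) (mat a′ b′ c′ d′) = left a b , right a b , left c d , right c d
    where
    left : ∀ x y → (x * a′ + y * c′) * d′ + (x * b′ + y * d′) * (- c′) ≈ (a′ * d′ - b′ * c′) * x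
    left x y = solve 6 (λ a′ b′ c′ d′ x y → (x :* a′ :+ y :* c′) :* d′ :+ (x :* b′ :+ y :* d′) :* (:- c′)
                                            := (a′ :* d′ :- b′ :* c′) :* x)
                       refl a′ b′ c′ d′ x y
    right : ∀ x y → (x * a′ + y * c′) * (- b′) + (x * b′ + y * d′) * a′ ≈ (a′ * d′ - b′ * c′) * y
    right x y = solve 6 (λ a′ b′ c′ d′ x y → (x :* a′ :+ y :* c′) :* (:- b′) :+ (x :* b′ :+ y :* d′) :* a′
                                             := (a′ :* d′ :- b′ :* c′) :* y)
                        refl a′ b′ c′ d′ x y

  ·M-identity : ∀ {r} A → r ≈ 1# → (r ·M A) ≈M A
  ·M-identity (mat a b c d) r≈1 = unit a , unit b , unit c , unit d
    where
    unit : ∀ x → _ * x ≈ x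
    unit x = trans (*-congʳ r≈1) (*-identityˡ x)

  ·M-cancel : ∀ {r s A B} → s * r ≈ 1# → (r ·M A) ≈M (r ·M B) → A ≈M B
  ·M-cancel {r} {s} {mat a b c d} {mat a′ b′ c′ d′} sr (p , q , p′ , q′) =
    cancel p , cancel q , cancel p′ , cancel q′
    where
    open Relation.Binary.Reasoning.Setoid setoid
    cancel : ∀ {x y} → r * x ≈ r * y → x ≈ y
    cancel {x} {y} rx≈ry = begin
      x              ≈⟨ *-identityˡ x ⟨
      1# * x         ≈⟨ *-congʳ sr ⟨
      s * r * x      ≈⟨ *-assoc s r x ⟩
      s * (r * x)    ≈⟨ *-congˡ rx≈ry ⟩
      s * (r * y)    ≈⟨ *-assoc s r y ⟨
      s * r * y      ≈⟨ *-congʳ sr ⟩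
      1# * y         ≈⟨ *-identityˡ y ⟩
      y              ∎

  ≈M-fromBasis : ∀ {A B u v s} → s * det u v ≈ 1# →
                 app A u ≈U app B u → app A v ≈U app B v → A ≈M B
  ≈M-fromBasis {A} {B} {u} {v} sd Au≈Bu Av≈Bv =
    ·M-cancel (trans (*-congˡ (detM-col u v)) sd) (begin
      detM P ·M A        ≈⟨ ∙-∙-adj A P ⟨
      (A ∙ P) ∙ adj P    ≈⟨ ∙-cong (≈M-trans (∙-col A u v) (≈M-trans (col-cong Au≈Bu Av≈Bv) (≈M-sym (∙-col B u v)))) ≈M-refl ⟩
      (B ∙ P) ∙ adj P    ≈⟨ ∙-∙-adj B P ⟩
      detM P ·M B        ∎)
    where
    open ≈M-Reasoning
    P = col u v

  ≈M-fromApp : ∀ {A B} → (∀ u → app A u ≈U app B u) → A ≈M B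
  ≈M-fromApp {A} {B} A≈B = ≈M-fromBasis {A} {B} {1# , 0#} {0# , 1#} {1#} det≈1 (A≈B _) (A≈B _)
    where
    det≈1 : 1# * det (1# , 0#) (0# , 1#) ≈ 1#
    det≈1 = solve 0 (con (+ 1) :* (con (+ 1) :* con (+ 1) :- con (+ 0) :* con (+ 0)) := con (+ 1)) refl

  rightInverse⇒leftInverse : ∀ A B → detM A ≈ 1# → (A ∙ B) ≈M I → (B ∙ A) ≈M I
  rightInverse⇒leftInverse A B detA≈1 AB≈I = begin
    B ∙ A                ≈⟨ ∙-cong B≈adjA ≈M-refl ⟩
    adj A ∙ A            ≈⟨ ∙-cong ≈M-refl (∙-identityʳ A) ⟨
    adj A ∙ (A ∙ I)      ≈⟨ adj-∙-∙ A I ⟩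
    detM A ·M I          ≈⟨ ·M-identity I detA≈1 ⟩
    I                    ∎
    where
    open ≈M-Reasoning
    B≈adjA : B ≈M adj A
    B≈adjA = begin
      B                  ≈⟨ ·M-identity B detA≈1 ⟨
      detM A ·M B        ≈⟨ adj-∙-∙ A B ⟨
      adj A ∙ (A ∙ B)    ≈⟨ ∙-cong ≈M-refl AB≈I ⟩
      adj A ∙ I          ≈⟨ ∙-identityʳ (adj A) ⟩
      adj A              ∎

  sending : U → U → U → U → M
  sending u v p q = col p q ∙ adj (col u v)

  app-sending₁ : ∀ {u v} p q → det u v ≈ 1# → app (sending u v p q) u ≈U p
  app-sending₁ {u₁ , u₂} {v₁ , v₂} (p₁ , p₂) (q₁ , q₂) det≈1 =
    ≈U-trans (row p₁ q₁ , row p₂ q₂) (≈U-trans (·U-cong det≈1 ≈U-refl) (·U-identityˡ _))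
    where
    row : ∀ p q → (p * v₂ + q * (- u₂)) * u₁ + (p * (- v₁) + q * u₁) * u₂ ≈ (u₁ * v₂ - u₂ * v₁) * p
    row p q = solve 6 (λ u₁ u₂ v₁ v₂ p q → (p :* v₂ :+ q :* (:- u₂)) :* u₁ :+ (p :* (:- v₁) :+ q :* u₁) :* u₂
                                         := (u₁ :* v₂ :- u₂ :* v₁) :* p) refl u₁ u₂ v₁ v₂ p q

  app-sending₂ : ∀ {u v} p q → det u v ≈ 1# → app (sending u v p q) v ≈U q
  app-sending₂ {u₁ , u₂} {v₁ , v₂} (p₁ , p₂) (q₁ , q₂) det≈1 =
    ≈U-trans (row p₁ q₁ , row p₂ q₂) (≈U-trans (·U-cong det≈1 ≈U-refl) (·U-identityˡ _))
    where
    row : ∀ p q → (p * v₂ + q * (- u₂)) * v₁ + (p * (- v₁) + q * u₁) * v₂ ≈ (u₁ * v₂ - u₂ * v₁) * q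
    row p q = solve 6 (λ u₁ u₂ v₁ v₂ p q → (p :* v₂ :+ q :* (:- u₂)) :* v₁ :+ (p :* (:- v₁) :+ q :* u₁) :* v₂
                                         := (u₁ :* v₂ :- u₂ :* v₁) :* q) refl u₁ u₂ v₁ v₂ p q

  detM-sending : ∀ u v p q → detM (sending u v p q) ≈ det p q * det u v
  detM-sending u v p q = begin
    detM (col p q ∙ adj (col u v))            ≈⟨ detM-∙ (col p q) _ ⟩
    detM (col p q) * detM (adj (col u v))     ≈⟨ *-cong (detM-col p q) (trans (detM-adj (col u v)) (detM-col u v)) ⟩
    det p q * det u v                         ∎
    where
    open Relation.Binary.Reasoning.Setoid setoid
    detM-adj : ∀ A → detM (adj A) ≈ detM A
    detM-adj (mat a b c d) = solve 4 (λ a b c d → d :* a :- (:- b) :* (:- c) := a :* d :- b :* c) refl a b c d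

  mirror : U → U → K → M
  mirror u a c = sending u a u ((c ·U u) −U a)

  app-mirror₁ : ∀ {u a} c → det u a ≈ 1# → app (mirror u a c) u ≈U u
  app-mirror₁ {u} c det≈1 = app-sending₁ u _ det≈1

  app-mirror₂ : ∀ {u a} c → det u a ≈ 1# → app (mirror u a c) a ≈U ((c ·U u) −U a)
  app-mirror₂ {u} c det≈1 = app-sending₂ u _ det≈1

  mirror-involutive : ∀ {u a} c → det u a ≈ 1# → (mirror u a c ∙ mirror u a c) ≈M I
  mirror-involutive {u} {a} c det≈1 = ≈M-fromBasis {s = 1#} (trans (*-identityˡ _) det≈1)
    (≈U-trans (app-∙ M′ M′ u) (≈U-trans (app-congʳ M′ (app-mirror₁ c det≈1)) (≈U-trans (app-mirror₁ c det≈1) (≈U-sym (app-I u)))))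
    (≈U-trans (app-∙ M′ M′ a) (≈U-trans (app-congʳ M′ (app-mirror₂ c det≈1)) (≈U-trans M′[cu−a]≈a (≈U-sym (app-I a)))))
    where
    M′ = mirror u a c
    M′[cu−a]≈a : app M′ ((c ·U u) −U a) ≈U a
    M′[cu−a]≈a = ≈U-trans (app-− M′ _ a)
                 (≈U-trans (−U-cong (≈U-trans (app-· M′ c u) (·U-cong refl (app-mirror₁ c det≈1))) (app-mirror₂ c det≈1))
                           (v−[v−a]≈a _ a))

  detM-mirror : ∀ {u a} c → det u a ≈ 1# → detM (mirror u a c) ≈ - 1#
  detM-mirror {u} {a} c det≈1 =
    trans (detM-sending u a u _) (trans (*-cong (trans (det-u[ru−a] c u a) (-‿cong det≈1)) det≈1) (*-identityʳ (- 1#)))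

  ≈±-refl : ∀ {u} → u ≈± u
  ≈±-refl = inj₁ ≈U-refl

  ≈±-sym : ∀ {u v} → u ≈± v → v ≈± u
  ≈±-sym     (inj₁ p) = inj₁ (≈U-sym p)
  ≈±-sym {v = v} (inj₂ p) = inj₂ (≈U-trans (≈U-sym (negU-involutive v)) (negU-cong (≈U-sym p)))

  ≈±-trans : ∀ {u v w} → u ≈± v → v ≈± w → u ≈± w
  ≈±-trans (inj₁ p) (inj₁ q) = inj₁ (≈U-trans p q)
  ≈±-trans (inj₁ p) (inj₂ q) = inj₂ (≈U-trans p q)
  ≈±-trans (inj₂ p) (inj₁ q) = inj₂ (≈U-trans p (negU-cong q))
  ≈±-trans {w = w} (inj₂ p) (inj₂ q) = inj₁ (≈U-trans p (≈U-trans (negU-cong q) (negU-involutive w)))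

  ≈±-respˡ : ∀ {u u′ v} → u ≈U u′ → u ≈± v → u′ ≈± v
  ≈±-respˡ p = ≈±-trans (inj₁ (≈U-sym p))

  ≈±-respʳ : ∀ {u v v′} → v ≈U v′ → u ≈± v → u ≈± v′
  ≈±-respʳ p q = ≈±-trans q (inj₁ p)

  app-≈± : ∀ A {u v} → u ≈± v → app A u ≈± app A v
  app-≈± A (inj₁ p) = inj₁ (app-congʳ A p)
  app-≈± A (inj₂ p) = inj₂ (≈U-trans (app-congʳ A p) (app-negU A _))

iter-+ : ∀ {a} {A : Set a} (h : A → A) m n x → iter h (m ℕ.+ n) x ≡ iter h m (iter h n x)
iter-+ h zero    n x = ≡.refl
iter-+ h (suc m) n x = ≡.cong h (iter-+ h m n x)

*3+≡*4 : ∀ n → n ℕ.* 3 ℕ.+ n ≡ n ℕ.* 4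
*3+≡*4 n = ≡.trans (ℕ.+-comm (n ℕ.* 3) n) (≡.sym (ℕ.*-suc n 3))

iter-not-*4 : ∀ n b → iter not (n ℕ.* 4) b ≡ b
iter-not-*4 zero    b = ≡.refl
iter-not-*4 (suc n) b = ≡.trans (Bool.not-involutive _) (≡.trans (Bool.not-involutive _) (iter-not-*4 n b))

iter-not-inverse : ∀ n b → iter not (n ℕ.* 3) (iter not n b) ≡ b
iter-not-inverse n b rewrite ≡.sym (iter-+ not (n ℕ.* 3) n b) | *3+≡*4 n = iter-not-*4 n b

module Geodesics {c ℓ g} (R : CommutativeRing c ℓ) (α : CommutativeRing.Carrier R)
  (C : Mat (CommutativeRing.Carrier R)) (G : Mat (CommutativeRing.Carrier R) → Set g) where
  open CommutativeRing R renaming (Carrier to K)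
  open Matrices R
  open IntegerCoefficients R using (solve; _:=_; _:+_; _:*_; _:-_; :-_; con)
  open XiConstruction R α C G
  open Tri

  TEq-refl : ∀ {t} → TEq t t
  TEq-refl = ≈U-refl , ≈U-refl , ≈U-refl , ≡.refl

  TEq-sym : ∀ {t s} → TEq t s → TEq s t
  TEq-sym (p , q , r , e) = ≈U-sym p , ≈U-sym q , ≈U-sym r , ≡.sym e

  TEq-trans : ∀ {t s r} → TEq t s → TEq s r → TEq t r
  TEq-trans (p , q , r , e) (p′ , q′ , r′ , e′) = ≈U-trans p p′ , ≈U-trans q q′ , ≈U-trans r r′ , ≡.trans e e′

  ρ-cong : ∀ {t s} → TEq t s → TEq (ρ t) (ρ s)
  ρ-cong (p , q , r , ≡.refl) = r , −U-cong r (·U-cong refl p) , q , ≡.refl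

  ρ²-cong : ∀ {t s} → TEq t s → TEq (ρ² t) (ρ² s)
  ρ²-cong p = ρ-cong (ρ-cong p)

  iterρ²-cong : ∀ n {t s} → TEq t s → TEq (iter ρ² n t) (iter ρ² n s)
  iterρ²-cong zero    p = p
  iterρ²-cong (suc n) p = ρ²-cong (iterρ²-cong n p)

  iterρ²-ρ : ∀ n t → iter ρ² n (ρ t) ≡ ρ (iter ρ² n t)
  iterρ²-ρ zero    t = ≡.refl
  iterρ²-ρ (suc n) t = ≡.cong ρ² (iterρ²-ρ n t)

  endpt-TEq : ∀ {t t′} s → TEq t t′ → endpt t s ≈U endpt t′ s
  endpt-TEq {tri _ _ _ _} {tri _ _ _ _} true  (x≈x′ , _) = x≈x′
  endpt-TEq {tri _ _ _ _} {tri _ _ _ _} false (_ , y≈y′ , _) = y≈y′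

  Balanced : Tri → Set ℓ
  Balanced t = (x t +U y t) ≈U (wval (w t) ·U z t)

  Balanced-TEq : ∀ {t s} → TEq t s → Balanced t → Balanced s
  Balanced-TEq (p , q , r , ≡.refl) b = ≈U-trans (+U-cong (≈U-sym p) (≈U-sym q)) (≈U-trans b (·U-cong refl r))

  mkInT : ∀ {x y z w} → ⟨ x , z ⟩ ≈ 1# → Balanced (tri x y z w) → InT (tri x y z w)
  mkInT {x} {y} {z} {w} ⟨x,z⟩≈1 b =
    (z , α , trans (*-comm _ α) ⟨x,z⟩≈1) ,
    (z , - α , -unit (trans (det-cong y≈wz−x ≈U-refl) (det-wz−x x z))) ,
    (x , - α , -unit (det-antisym x z)) ,
    ⟨x,z⟩≈1 ,
    trans (*-congˡ (trans (det-cong ≈U-refl y≈wz−x) (det-z[wz−x] x z))) ⟨x,z⟩≈1 ,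
    b
    where
    y≈wz−x = y≈v−x b
    det-wz−x : ∀ x z → det ((wval w ·U z) −U x) z ≈ - det x z
    det-wz−x (x₁ , x₂) (z₁ , z₂) =
      solve 5 (λ r x₁ x₂ z₁ z₂ → (r :* z₁ :- x₁) :* z₂ :- (r :* z₂ :- x₂) :* z₁ := :- (x₁ :* z₂ :- x₂ :* z₁)) refl (wval w) x₁ x₂ z₁ z₂
    det-z[wz−x] : ∀ x z → det z ((wval w ·U z) −U x) ≈ det x z
    det-z[wz−x] (x₁ , x₂) (z₁ , z₂) =
      solve 5 (λ r x₁ x₂ z₁ z₂ → z₁ :* (r :* z₂ :- x₂) :- z₂ :* (r :* z₁ :- x₁) := x₁ :* z₂ :- x₂ :* z₁) refl (wval w) x₁ x₂ z₁ z₂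
    -unit : ∀ {e} → e ≈ - det x z → e * - α ≈ 1#
    -unit {e} e≈ = begin
      e * - α               ≈⟨ *-congʳ e≈ ⟩
      - det x z * - α       ≈⟨ solve 2 (λ d a → :- d :* :- a := a :* d) refl (det x z) α ⟩
      α * det x z           ≈⟨ ⟨x,z⟩≈1 ⟩
      1#                    ∎
      where open Relation.Binary.Reasoning.Setoid setoid

  InT-TEq : ∀ {t s} → TEq t s → InT t → InT s
  InT-TEq {tri _ _ _ _} {tri _ _ _ w} e@(p , _ , r , ≡.refl) (_ , _ , _ , ⟨x,z⟩≈1 , _ , b) =
    mkInT {w = w} (trans (*-congˡ (det-cong (≈U-sym p) (≈U-sym r))) ⟨x,z⟩≈1) (Balanced-TEq e b)

  InT⇒Balanced : ∀ t → InT t → Balanced t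
  InT⇒Balanced t (_ , _ , _ , _ , _ , b) = b

  ⟨x,y⟩≈w : ∀ x y z w → InT (tri x y z w) → ⟨ x , y ⟩ ≈ wval w
  ⟨x,y⟩≈w x y z w (_ , _ , _ , ⟨x,z⟩≈1 , _ , b) = begin
    α * det x y                          ≈⟨ *-congˡ (det-cong ≈U-refl (y≈v−x b)) ⟩
    α * det x ((wval w ·U z) −U x)        ≈⟨ *-congˡ (det-x[rz−x] x z) ⟩
    α * (wval w * det x z)                ≈⟨ solve 3 (λ a r d → a :* (r :* d) := r :* (a :* d)) refl α (wval w) (det x z) ⟩
    wval w * ⟨ x , z ⟩                    ≈⟨ *-congˡ ⟨x,z⟩≈1 ⟩
    wval w * 1#                          ≈⟨ *-identityʳ _ ⟩
    wval w                               ∎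
    where
    open Relation.Binary.Reasoning.Setoid setoid
    det-x[rz−x] : ∀ x z → det x ((wval w ·U z) −U x) ≈ wval w * det x z
    det-x[rz−x] (x₁ , x₂) (z₁ , z₂) =
      solve 5 (λ r x₁ x₂ z₁ z₂ → x₁ :* (r :* z₂ :- x₂) :- x₂ :* (r :* z₁ :- x₁) := r :* (x₁ :* z₂ :- x₂ :* z₁)) refl (wval w) x₁ x₂ z₁ z₂

  wval-comp-* : ∀ w → wval (comp w) * wval w ≈ two
  wval-comp-* w1 = *-identityʳ _
  wval-comp-* w2 = *-identityˡ _

  InT-ρ : ∀ t → InT t → InT (ρ t)
  InT-ρ (tri x y z w) (_ , _ , _ , _ , ⟨z,y⟩≈1 , b) =
    mkInT {w = comp w} ⟨z,y⟩≈1 (≈U-trans (balance w x z) (·U-cong refl (≈U-sym (y≈v−x b))))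
    where
    balance : ∀ w x z → (z +U (z −U (wval (comp w) ·U x))) ≈U (wval (comp w) ·U ((wval w ·U z) −U x))
    balance w1 (x₁ , x₂) (z₁ , z₂) = e x₁ z₁ , e x₂ z₂
      where
      e : ∀ x z → z + (z - (1# + 1#) * x) ≈ (1# + 1#) * (1# * z - x)
      e = solve 2 (λ x z → z :+ (z :- con (+ 2) :* x) := con (+ 2) :* (con (+ 1) :* z :- x)) refl
    balance w2 (x₁ , x₂) (z₁ , z₂) = e x₁ z₁ , e x₂ z₂
      where
      e : ∀ x z → z + (z - 1# * x) ≈ 1# * ((1# + 1#) * z - x)
      e = solve 2 (λ x z → z :+ (z :- con (+ 1) :* x) := con (+ 1) :* (con (+ 2) :* z :- x)) refl

  InT-ρ² : ∀ t → InT t → InT (ρ² t)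
  InT-ρ² t t∈𝒯 = InT-ρ (ρ t) (InT-ρ t t∈𝒯)

  InT-iterρ² : ∀ n t → InT t → InT (iter ρ² n t)
  InT-iterρ² zero    t t∈𝒯 = t∈𝒯
  InT-iterρ² (suc n) t t∈𝒯 = InT-ρ² (iter ρ² n t) (InT-iterρ² n t t∈𝒯)

  -- The two clauses agree; splitting on w lets comp (comp w) reduce to w.
  ρ²-balanced : ∀ {x y z} w → Balanced (tri x y z w) →
                TEq (ρ² (tri x y z w)) (tri y (negU x) (z −U (wval (comp w) ·U x)) w)
  ρ²-balanced w1 b = ≈U-refl , y−v≈-x b , ≈U-refl , ≡.refl
  ρ²-balanced w2 b = ≈U-refl , y−v≈-x b , ≈U-refl , ≡.refl

  negT : Tri → Tri
  negT (tri x y z w) = tri (negU x) (negU y) (negU z) w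

  ρ⁴≈negT : ∀ t → InT t → TEq (iter ρ² 2 t) (negT t)
  ρ⁴≈negT (tri x y z w) t∈𝒯@(_ , _ , _ , _ , _ , b) =
    TEq-trans (ρ²-cong ρ²t≈) (TEq-trans (ρ²-balanced w b′) (≈U-refl , ≈U-refl , z″≈-z , ≡.refl))
    where
    ρ²t≈ = ρ²-balanced w b
    b′ = Balanced-TEq {ρ² (tri x y z w)} {tri y (negU x) (z −U (wval (comp w) ·U x)) w} ρ²t≈
                      (InT⇒Balanced (ρ² (tri x y z w)) (InT-ρ² (tri x y z w) t∈𝒯))
    shift : ∀ w x z → ((z −U (wval (comp w) ·U x)) −U (wval (comp w) ·U ((wval w ·U z) −U x))) ≈U negU z
    shift w1 (x₁ , x₂) (z₁ , z₂) = e x₁ z₁ , e x₂ z₂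
      where
      e : ∀ x z → (z - (1# + 1#) * x) - (1# + 1#) * (1# * z - x) ≈ - z
      e = solve 2 (λ x z → (z :- con (+ 2) :* x) :- con (+ 2) :* (con (+ 1) :* z :- x) := :- z) refl
    shift w2 (x₁ , x₂) (z₁ , z₂) = e x₁ z₁ , e x₂ z₂
      where
      e : ∀ x z → (z - 1# * x) - 1# * ((1# + 1#) * z - x) ≈ - z
      e = solve 2 (λ x z → (z :- con (+ 1) :* x) :- con (+ 1) :* (con (+ 2) :* z :- x) := :- z) refl
    z″≈-z = ≈U-trans (−U-cong ≈U-refl (·U-cong refl (y≈v−x b))) (shift w x z)

  ρ⁸≈id : ∀ t → InT t → TEq (iter ρ² 4 t) t
  ρ⁸≈id t@(tri x y z w) t∈𝒯 =
    TEq-trans (iterρ²-cong 2 (ρ⁴≈negT t t∈𝒯))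
    (TEq-trans (ρ⁴≈negT (negT t) (InT-TEq (ρ⁴≈negT t t∈𝒯) (InT-iterρ² 2 t t∈𝒯)))
               (negU-involutive x , negU-involutive y , negU-involutive z , ≡.refl))

  iterρ²-*4 : ∀ n t → InT t → TEq (iter ρ² (n ℕ.* 4) t) t
  iterρ²-*4 zero    t t∈𝒯 = TEq-refl
  iterρ²-*4 (suc n) t t∈𝒯 = TEq-trans (iterρ²-cong 4 (iterρ²-*4 n t t∈𝒯)) (ρ⁸≈id t t∈𝒯)

  iterρ²-inverse : ∀ n t → InT t → TEq (iter ρ² (n ℕ.* 3) (iter ρ² n t)) t
  iterρ²-inverse n t t∈𝒯 rewrite ≡.sym (iter-+ ρ² (n ℕ.* 3) n t) | *3+≡*4 n = iterρ²-*4 n t t∈𝒯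

  actT-congT : ∀ h {t s} → TEq t s → TEq (actT h t) (actT h s)
  actT-congT h (p , q , r , e) = app-congʳ h p , app-congʳ h q , app-congʳ h r , e

  actT-congM : ∀ {A B} t → A ≈M B → TEq (actT A t) (actT B t)
  actT-congM t A≈B = app-cong A≈B ≈U-refl , app-cong A≈B ≈U-refl , app-cong A≈B ≈U-refl , ≡.refl

  actT-ρ : ∀ h t → TEq (actT h (ρ t)) (ρ (actT h t))
  actT-ρ h (tri x y z w) = ≈U-refl , ≈U-trans (app-− h _ _) (−U-cong ≈U-refl (app-· h _ _)) , ≈U-refl , ≡.refl

  actT-iterρ² : ∀ n h t → TEq (actT h (iter ρ² n t)) (iter ρ² n (actT h t))
  actT-iterρ² zero    h t = TEq-refl
  actT-iterρ² (suc n) h t =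
    TEq-trans (actT-ρ h (ρ (iter ρ² n t))) (ρ-cong (TEq-trans (actT-ρ h (iter ρ² n t)) (ρ-cong (actT-iterρ² n h t))))

  actT-∙ : ∀ A B t → TEq (actT (A ∙ B) t) (actT A (actT B t))
  actT-∙ A B t = app-∙ A B _ , app-∙ A B _ , app-∙ A B _ , ≡.refl

  actT-I : ∀ t → TEq (actT I t) t
  actT-I t = app-I _ , app-I _ , app-I _ , ≡.refl

  InT-actT : ∀ {h} t → detM h ≈ 1# → InT t → InT (actT h t)
  InT-actT {h} (tri x y z w) det≈1 (_ , _ , _ , ⟨x,z⟩≈1 , _ , b) =
    mkInT {w = w} (trans (*-congˡ (trans (det-app h x z) (trans (*-congʳ det≈1) (*-identityˡ _)))) ⟨x,z⟩≈1)
                  (≈U-trans (≈U-sym (app-+ h x y)) (≈U-trans (app-congʳ h b) (app-· h _ z)))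

  Orb-refl : ∀ {t} → Orb t t
  Orb-refl = 0 , TEq-refl

  TEq⇒Orb : ∀ {t s} → TEq t s → Orb t s
  TEq⇒Orb e = 0 , e

  Orb-trans : ∀ {a b d} → Orb a b → Orb b d → Orb a d
  Orb-trans {a} (n , p) (m , q) = m ℕ.+ n , ≡.subst (λ e → TEq e _) (≡.sym (iter-+ ρ² m n a)) (TEq-trans (iterρ²-cong m p) q)

  Orb-TEqˡ : ∀ {a b d} → TEq a b → Orb b d → Orb a d
  Orb-TEqˡ e = Orb-trans (TEq⇒Orb e)

  Orb-TEqʳ : ∀ {a b d} → Orb a b → TEq b d → Orb a d
  Orb-TEqʳ (n , p) e = n , TEq-trans p e

  Orb-sym : ∀ {a b} → InT a → Orb a b → Orb b a
  Orb-sym {a} a∈𝒯 (n , p) = n ℕ.* 3 , TEq-trans (iterρ²-cong (n ℕ.* 3) (TEq-sym p)) (iterρ²-inverse n a a∈𝒯)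

  Orb-ρ : ∀ {a b} → Orb a b → Orb (ρ a) (ρ b)
  Orb-ρ {a} (n , p) = n , ≡.subst (λ e → TEq e _) (≡.sym (iterρ²-ρ n a)) (ρ-cong p)

  Orb-ρ² : ∀ {a} → InT a → Orb (ρ² a) a
  Orb-ρ² {a} a∈𝒯 = 3 , ρ⁸≈id a a∈𝒯

  Orb-actT : ∀ h {a b} → Orb a b → Orb (actT h a) (actT h b)
  Orb-actT h {a} (n , p) = n , TEq-trans (TEq-sym (actT-iterρ² n h a)) (actT-congT h p)

  InT-Orb : ∀ {a b} → Orb a b → InT a → InT b
  InT-Orb {a} (n , p) a∈𝒯 = InT-TEq p (InT-iterρ² n a a∈𝒯)

  Orb-actT-∙ : ∀ h k {a b d} → Orb (actT h a) b → Orb (actT k b) d → Orb (actT (k ∙ h) a) d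
  Orb-actT-∙ h k {a} ha~b kb~d = Orb-TEqˡ (actT-∙ k h a) (Orb-trans (Orb-actT k ha~b) kb~d)

  Orb-actT-inverse : ∀ h h⁻¹ {a b} → (h⁻¹ ∙ h) ≈M I → InT a → Orb (actT h a) b → Orb (actT h⁻¹ b) a
  Orb-actT-inverse h h⁻¹ {a} h⁻¹h≈I a∈𝒯 ha~b =
    Orb-sym a∈𝒯 (Orb-TEqˡ (TEq-sym h⁻¹ha≈a) (Orb-actT h⁻¹ ha~b))
    where
    h⁻¹ha≈a : TEq (actT h⁻¹ (actT h a)) a
    h⁻¹ha≈a = TEq-trans (TEq-sym (actT-∙ h⁻¹ h a)) (TEq-trans (actT-congM a h⁻¹h≈I) (actT-I a))

  intersect-sym : ∀ {a b} → InT a → Orb (ρ a) b → Orb (ρ b) a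
  intersect-sym {a} a∈𝒯 ρa~b = Orb-trans (Orb-ρ (Orb-sym (InT-ρ a a∈𝒯) ρa~b)) (Orb-ρ² a∈𝒯)

  Contains-TEq : ∀ {γ δ p} → TEq (Geo.tr γ) (Geo.tr δ) → Contains γ p → Contains δ p
  Contains-TEq γ≈δ (inj₁ a~γ) = inj₁ (Orb-TEqʳ a~γ γ≈δ)
  Contains-TEq γ≈δ (inj₂ b~γ) = inj₂ (Orb-TEqʳ b~γ γ≈δ)

  PEq-refl : ∀ p → PEq I p p
  PEq-refl (ell a b _) = inj₁ (TEq⇒Orb (actT-I (Geo.tr a)) , TEq⇒Orb (actT-I (Geo.tr b)))

  PEq-cong : ∀ {h h′} p q → h ≈M h′ → PEq h p q → PEq h′ p q
  PEq-cong (ell a b _) q h≈h′ (inj₁ (o , o′)) =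
    inj₁ (Orb-TEqˡ (actT-congM (Geo.tr a) (≈M-sym h≈h′)) o , Orb-TEqˡ (actT-congM (Geo.tr b) (≈M-sym h≈h′)) o′)
  PEq-cong (ell a b _) q h≈h′ (inj₂ (o , o′)) =
    inj₂ (Orb-TEqˡ (actT-congM (Geo.tr a) (≈M-sym h≈h′)) o , Orb-TEqˡ (actT-congM (Geo.tr b) (≈M-sym h≈h′)) o′)

  PEq-∙ : ∀ h k {p q r} → PEq h p q → PEq k q r → PEq (k ∙ h) p r
  PEq-∙ h k (inj₁ (a₁ , a₂)) (inj₁ (b₁ , b₂)) = inj₁ (Orb-actT-∙ h k a₁ b₁ , Orb-actT-∙ h k a₂ b₂)
  PEq-∙ h k (inj₁ (a₁ , a₂)) (inj₂ (b₁ , b₂)) = inj₂ (Orb-actT-∙ h k a₁ b₁ , Orb-actT-∙ h k a₂ b₂)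
  PEq-∙ h k (inj₂ (a₁ , a₂)) (inj₁ (b₁ , b₂)) = inj₂ (Orb-actT-∙ h k a₁ b₂ , Orb-actT-∙ h k a₂ b₁)
  PEq-∙ h k (inj₂ (a₁ , a₂)) (inj₂ (b₁ , b₂)) = inj₁ (Orb-actT-∙ h k a₁ b₂ , Orb-actT-∙ h k a₂ b₁)

  PEq-inverse : ∀ h h⁻¹ {p q} → (h⁻¹ ∙ h) ≈M I → PEq h p q → PEq h⁻¹ q p
  PEq-inverse h h⁻¹ {ell a b _} inv (inj₁ (a₁ , a₂)) =
    inj₁ (Orb-actT-inverse h h⁻¹ inv (Geo.inT a) a₁ , Orb-actT-inverse h h⁻¹ inv (Geo.inT b) a₂)
  PEq-inverse h h⁻¹ {ell a b _} inv (inj₂ (a₁ , a₂)) =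
    inj₂ (Orb-actT-inverse h h⁻¹ inv (Geo.inT b) a₂ , Orb-actT-inverse h h⁻¹ inv (Geo.inT a) a₁)

  -- An elliptic vertex is determined by any geodesic containing it, so matching
  -- geodesics force matching elliptic vertices.
  PEq-contained : ∀ {γ δ p q} m → Contains γ p → Contains δ q →
                  Orb (actT m (Geo.tr γ)) (Geo.tr δ) → PEq m p q
  PEq-contained {γ} {δ} {ell a b ρa~b} {ell a′ b′ ρa′~b′} m γ∋p δ∋q mγ~δ = match γ∋p δ∋q
    where
    A = Geo.tr a
    B = Geo.tr b
    A′ = Geo.tr a′
    B′ = Geo.tr b′
    b~ρa : Orb B (ρ A)
    b~ρa = Orb-sym (InT-ρ A (Geo.inT a)) ρa~b
    a~ρb : Orb A (ρ B)
    a~ρb = Orb-sym (InT-ρ B (Geo.inT b)) (intersect-sym (Geo.inT a) ρa~b)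
    ρb′~a′ : Orb (ρ B′) A′
    ρb′~a′ = intersect-sym (Geo.inT a′) ρa′~b′
    partner : ∀ {X X′ Y} → Orb (actT m X) Y → Orb X′ (ρ X) → Orb (actT m X′) (ρ Y)
    partner {X} mX~Y X′~ρX = Orb-trans (Orb-actT m X′~ρX) (Orb-trans (TEq⇒Orb (actT-ρ m X)) (Orb-ρ mX~Y))
    via : ∀ {X Y} → Orb X (Geo.tr γ) → (Y∈𝒯 : InT Y) → Orb Y (Geo.tr δ) → Orb (actT m X) Y
    via X~γ Y∈𝒯 Y~δ = Orb-trans (Orb-actT m X~γ) (Orb-trans mγ~δ (Orb-sym Y∈𝒯 Y~δ))
    match : Contains γ (ell a b ρa~b) → Contains δ (ell a′ b′ ρa′~b′) → PEq m (ell a b ρa~b) (ell a′ b′ ρa′~b′)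
    match (inj₁ a~γ) (inj₁ a′~δ) = inj₁ (ma , Orb-trans (partner ma b~ρa) ρa′~b′)
      where ma = via a~γ (Geo.inT a′) a′~δ
    match (inj₁ a~γ) (inj₂ b′~δ) = inj₂ (ma , Orb-trans (partner ma b~ρa) ρb′~a′)
      where ma = via a~γ (Geo.inT b′) b′~δ
    match (inj₂ b~γ) (inj₁ a′~δ) = inj₂ (Orb-trans (partner mb a~ρb) ρa′~b′ , mb)
      where mb = via b~γ (Geo.inT a′) a′~δ
    match (inj₂ b~γ) (inj₂ b′~δ) = inj₁ (Orb-trans (partner mb a~ρb) ρb′~a′ , mb)
      where mb = via b~γ (Geo.inT b′) b′~δ

  CondC-TEq : ∀ {t s} → TEq t s → CondC t → CondC s
  CondC-TEq {tri _ _ _ _} {tri _ _ _ _} (p , q , _ , ≡.refl) (h , h∈G , eqs) = h , h∈G , λ u →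
    ≈U-trans (proj₁ (eqs u)) (·U-cong (*-congˡ (*-congˡ (det-cong ≈U-refl p))) q) ,
    ≈U-trans (proj₂ (eqs u)) (·U-cong (*-congˡ (*-congˡ (det-cong ≈U-refl q))) p)

  module UnderNegation (G-∙ : ∀ {A B} → G A → G B → G (A ∙ B)) (G-negI : G negI) where

    CondC-swap : ∀ x y z z′ w → CondC (tri x y z w) → CondC (tri y (negU x) z′ w)
    CondC-swap x y z z′ w (h , h∈G , eqs) = negI ∙ h , G-∙ G-negI h∈G , λ u →
      let k = wval (comp w)
          v = app C (app h u)
          C[-h]u≈-v : app C (app (negI ∙ h) u) ≈U negU v
          C[-h]u≈-v = ≈U-trans (app-congʳ C (≈U-trans (app-∙ negI h u) (app-negI _))) (app-negU C _)
      in (begin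
           app C (app (negI ∙ h) u) −U u   ≈⟨ −U-cong C[-h]u≈-v ≈U-refl ⟩
           negU v −U u                     ≈⟨ negU-+ v u ⟨
           negU (v +U u)                   ≈⟨ negU-cong (proj₂ (eqs u)) ⟩
           negU ((k * ⟨ u , y ⟩) ·U x)     ≈⟨ negU-· _ x ⟩
           (k * ⟨ u , y ⟩) ·U negU x       ∎) ,
         (begin
           app C (app (negI ∙ h) u) +U u   ≈⟨ +U-cong C[-h]u≈-v ≈U-refl ⟩
           negU v +U u                     ≈⟨ negU-− v u ⟨
           negU (v −U u)                   ≈⟨ negU-cong (proj₁ (eqs u)) ⟩
           negU ((k * ⟨ u , x ⟩) ·U y)     ≈⟨ ·U-negˡ _ y ⟨
           (- (k * ⟨ u , x ⟩)) ·U y        ≈⟨ ·U-cong (k⟨u,-x⟩ k u) ≈U-refl ⟨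
           (k * ⟨ u , negU x ⟩) ·U y       ∎)
      where
      open ≈U-Reasoning
      k⟨u,-x⟩ : ∀ k u → k * ⟨ u , negU x ⟩ ≈ - (k * ⟨ u , x ⟩)
      k⟨u,-x⟩ k u = trans (*-congˡ (*-congˡ (det-negUʳ u x)))
                          (solve 3 (λ k a d → k :* (a :* :- d) := :- (k :* (a :* d))) refl k α (det u x))

    CondC-ρ² : ∀ t → InT t → CondC t → CondC (ρ² t)
    CondC-ρ² (tri x y z w) t∈𝒯 t⊨c =
      CondC-TEq (TEq-sym (ρ²-balanced w (InT⇒Balanced (tri x y z w) t∈𝒯))) (CondC-swap x y z (z −U (wval (comp w) ·U x)) w t⊨c)

    CondC-iterρ² : ∀ n t → InT t → CondC t → CondC (iter ρ² n t)
    CondC-iterρ² zero    t t∈𝒯 t⊨c = t⊨c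
    CondC-iterρ² (suc n) t t∈𝒯 t⊨c = CondC-ρ² (iter ρ² n t) (InT-iterρ² n t t∈𝒯) (CondC-iterρ² n t t∈𝒯 t⊨c)

    CondC-Orb⁻¹ : ∀ {a b} → Orb a b → InT a → CondC b → CondC a
    CondC-Orb⁻¹ {a} a~b a∈𝒯 b⊨c with Orb-sym a∈𝒯 a~b
    ... | n , p = CondC-TEq p (CondC-iterρ² n _ (InT-Orb a~b a∈𝒯) b⊨c)

    Contains⇒CondC-ρ : ∀ {γ p} → Contains γ p → CondC (ρ (Geo.tr γ))
    Contains⇒CondC-ρ {γ} {ell a b ρa~b} (inj₁ a~γ) =
      CondC-Orb⁻¹ (Orb-trans (Orb-sym (InT-ρ (Geo.tr a) (Geo.inT a)) (Orb-ρ a~γ)) ρa~b) (InT-ρ (Geo.tr γ) (Geo.inT γ)) (Geo.cc b)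
    Contains⇒CondC-ρ {γ} {ell a b ρa~b} (inj₂ b~γ) =
      CondC-Orb⁻¹ (Orb-trans (Orb-sym (InT-ρ (Geo.tr b) (Geo.inT b)) (Orb-ρ b~γ)) (intersect-sym (Geo.inT a) ρa~b)) (InT-ρ (Geo.tr γ) (Geo.inT γ)) (Geo.cc a)

    ellipticAt : (γ : Geo) → CondC (ρ (Geo.tr γ)) → Ell
    ellipticAt γ ργ⊨c = ell γ (geo (ρ (Geo.tr γ)) (InT-ρ (Geo.tr γ) (Geo.inT γ)) ργ⊨c) Orb-refl

  module OrbitRelations (G-∙ : ∀ {A B} → G A → G B → G (A ∙ B))
                        (G-inverse : ∀ {A} → G A → Σ M λ B → G B × ((B ∙ A) ≈M I)) where

    VRel-trans : ∀ a b d → VRel a b → VRel b d → VRel a d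
    VRel-trans (inj₁ (u , _)) (inj₁ _) (inj₁ _) (h , h∈G , hu≈±v) (k , k∈G , kv≈±w) =
      k ∙ h , G-∙ k∈G h∈G , ≈±-respˡ (≈U-sym (app-∙ k h u)) (≈±-trans (app-≈± k hu≈±v) kv≈±w)
    VRel-trans (inj₂ p) (inj₂ q) (inj₂ r) (h , h∈G , hp≈q) (k , k∈G , kq≈r) =
      k ∙ h , G-∙ k∈G h∈G , PEq-∙ h k {p} {q} {r} hp≈q kq≈r

    VRel-sym : ∀ a b → VRel a b → VRel b a
    VRel-sym (inj₁ (u , _)) (inj₁ _) (h , h∈G , hu≈±v) with G-inverse h∈G
    ... | h⁻¹ , h⁻¹∈G , h⁻¹h≈I =
      h⁻¹ , h⁻¹∈G , ≈±-respʳ (≈U-trans (≈U-sym (app-∙ h⁻¹ h u)) (≈U-trans (app-cong h⁻¹h≈I ≈U-refl) (app-I u)))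
                             (app-≈± h⁻¹ (≈±-sym hu≈±v))
    VRel-sym (inj₂ p) (inj₂ q) (h , h∈G , hp≈q) with G-inverse h∈G
    ... | h⁻¹ , h⁻¹∈G , h⁻¹h≈I = h⁻¹ , h⁻¹∈G , PEq-inverse h h⁻¹ {p} {q} h⁻¹h≈I hp≈q

    ERel-trans : ∀ a b d → ERel a b → ERel b d → ERel a d
    ERel-trans (inj₁ _) (inj₁ _) (inj₁ _) (h , h∈G , hγ~δ) (k , k∈G , kδ~ε) =
      k ∙ h , G-∙ k∈G h∈G , Orb-actT-∙ h k hγ~δ kδ~ε
    ERel-trans (inj₂ (half γ₁ p₁ _ s₁)) (inj₂ (half γ₂ p₂ _ _)) (inj₂ (half γ₃ p₃ _ _))
               (h , h∈G , (n , hγ₁≈ , s₁≡) , hp₁≈p₂) (k , k∈G , (m , kγ₂≈ , s₂≡) , kp₂≈p₃) =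
      k ∙ h , G-∙ k∈G h∈G ,
      (m ℕ.+ n , ≡.subst (λ e → TEq e (Geo.tr γ₃)) (≡.sym (iter-+ ρ² m n _)) chain ,
                 ≡.trans (iter-+ not m n s₁) (≡.trans (≡.cong (iter not m) s₁≡) s₂≡)) ,
      PEq-∙ h k {p₁} {p₂} {p₃} hp₁≈p₂ kp₂≈p₃
      where
      t₁ = Geo.tr γ₁
      chain : TEq (iter ρ² m (iter ρ² n (actT (k ∙ h) t₁))) (Geo.tr γ₃)
      chain = TEq-trans (iterρ²-cong m (TEq-trans (iterρ²-cong n (actT-∙ k h t₁)) (TEq-sym (actT-iterρ² n k (actT h t₁)))))
                        (TEq-trans (iterρ²-cong m (actT-congT k hγ₁≈)) kγ₂≈)

    ERel-sym : ∀ a b → ERel a b → ERel b a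
    ERel-sym (inj₁ (γ , _)) (inj₁ _) (h , h∈G , hγ~δ) with G-inverse h∈G
    ... | h⁻¹ , h⁻¹∈G , h⁻¹h≈I = h⁻¹ , h⁻¹∈G , Orb-actT-inverse h h⁻¹ h⁻¹h≈I (Geo.inT γ) hγ~δ
    ERel-sym (inj₂ (half γ₁ p₁ _ s₁)) (inj₂ (half γ₂ p₂ _ _)) (h , h∈G , (n , hγ₁≈ , s₁≡) , hp₁≈p₂) with G-inverse h∈G
    ... | h⁻¹ , h⁻¹∈G , h⁻¹h≈I =
      h⁻¹ , h⁻¹∈G ,
      (n ℕ.* 3 , chain , ≡.trans (≡.cong (iter not (n ℕ.* 3)) (≡.sym s₁≡)) (iter-not-inverse n s₁)) ,
      PEq-inverse h h⁻¹ {p₁} {p₂} h⁻¹h≈I hp₁≈p₂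
      where
      t₁ = Geo.tr γ₁
      chain : TEq (iter ρ² (n ℕ.* 3) (actT h⁻¹ (Geo.tr γ₂))) t₁
      chain = TEq-trans (iterρ²-cong (n ℕ.* 3) (TEq-trans (actT-congT h⁻¹ (TEq-sym hγ₁≈))
                          (TEq-trans (actT-iterρ² n h⁻¹ (actT h t₁))
                          (iterρ²-cong n (TEq-trans (TEq-sym (actT-∙ h⁻¹ h t₁)) (TEq-trans (actT-congM t₁ h⁻¹h≈I) (actT-I t₁)))))))
                        (iterρ²-inverse n t₁ (Geo.inT γ₁))

  [C∙A]ᶜ∙[C∙A]≈I : ∀ {A} → (C ∙ C) ≈M I → (A ∙ A) ≈M I → (((C ∙ A) ᶜ) ∙ (C ∙ A)) ≈M I
  [C∙A]ᶜ∙[C∙A]≈I {A} C²≈I A²≈I = ≈M-fromApp λ v → begin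
    app (((C ∙ A) ᶜ) ∙ (C ∙ A)) v                   ≈⟨ ≈U-trans (app-∙ _ (C ∙ A) v) (app-∙ C _ _) ⟩
    app C (app ((C ∙ A) ∙ C) (app (C ∙ A) v))       ≈⟨ app-congʳ C (≈U-trans (app-∙ (C ∙ A) C _) (app-∙ C A _)) ⟩
    app C (app C (app A (app C (app (C ∙ A) v))))   ≈⟨ app-involution C²≈I _ ⟩
    app A (app C (app (C ∙ A) v))                   ≈⟨ app-congʳ A (≈U-trans (app-congʳ C (app-∙ C A v)) (app-involution C²≈I _)) ⟩
    app A (app A v)                                 ≈⟨ app-involution A²≈I v ⟩
    v                                               ≈⟨ app-I v ⟨
    app I v                                         ∎
    where open ≈U-Reasoning

  IsBasisVector-cong : ∀ {u v} → u ≈U v → IsBasisVector u → IsBasisVector v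
  IsBasisVector-cong u≈v (u′ , s , unit) = u′ , s , trans (*-congʳ (det-cong (≈U-sym u≈v) ≈U-refl)) unit

  IsBasisVector-negU : ∀ {u} → IsBasisVector u → IsBasisVector (negU u)
  IsBasisVector-negU {u} (u′ , s , unit) = negU u′ , s , trans (*-congʳ (det-negU u u′)) unit

  IsBasisVector-app : ∀ {h u} → detM h ≈ 1# → IsBasisVector u → IsBasisVector (app h u)
  IsBasisVector-app {h} {u} det≈1 (u′ , s , unit) =
    app h u′ , s , trans (*-congʳ (trans (det-app h u u′) (trans (*-congʳ det≈1) (*-identityˡ _)))) unit

  unimodularPartner : ∀ {u} → IsBasisVector u → Σ U λ v → det u v ≈ 1#
  unimodularPartner {u} (v , s , unit) = s ·U v , trans (det-·ʳ s u v) (trans (*-comm s _) unit)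

  IsParabolic-cong : ∀ {u v} → u ≈U v → IsParabolic u → IsParabolic v
  IsParabolic-cong u≈v (u-basis , h , h-adm , Chu≈u) =
    IsBasisVector-cong u≈v u-basis , h , h-adm ,
    ≈U-trans (app-congʳ C (app-congʳ h (≈U-sym u≈v))) (≈U-trans Chu≈u u≈v)

  IsParabolic-± : ∀ {u v} → u ≈± v → IsParabolic u → IsParabolic v
  IsParabolic-± (inj₁ u≈v) u-par = IsParabolic-cong u≈v u-par
  IsParabolic-± {u} {v} (inj₂ u≈-v) (u-basis , h , h-adm , Chu≈u) =
    IsParabolic-cong (≈U-trans (negU-cong u≈-v) (negU-involutive v))
      (IsBasisVector-negU u-basis , h , h-adm ,
       ≈U-trans (app-congʳ C (app-negU h u)) (≈U-trans (app-negU C _) (negU-cong Chu≈u)))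

  endpt-IsBasisVector : ∀ t s → InT t → IsBasisVector (endpt t s)
  endpt-IsBasisVector (tri _ _ _ _) true  (x-basis , _) = x-basis
  endpt-IsBasisVector (tri _ _ _ _) false (_ , y-basis , _) = y-basis

  reflection : U → U → K → M
  reflection (x₁ , x₂) (y₁ , y₂) k =
    mat (1# + k * α * x₂ * y₁) (- (k * α * x₁ * y₁)) (k * α * x₂ * y₂) (1# - k * α * x₁ * y₂)

  app-reflection : ∀ x y k u → app (reflection x y k) u ≈U (u +U ((k * ⟨ u , x ⟩) ·U y))
  app-reflection (x₁ , x₂) (y₁ , y₂) k (u₁ , u₂) =
    solve 8 (λ k a x₁ x₂ y₁ y₂ u₁ u₂ → (con (+ 1) :+ k :* a :* x₂ :* y₁) :* u₁ :+ :- (k :* a :* x₁ :* y₁) :* u₂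
                                      := u₁ :+ (k :* (a :* (u₁ :* x₂ :- u₂ :* x₁))) :* y₁) refl k α x₁ x₂ y₁ y₂ u₁ u₂ ,
    solve 8 (λ k a x₁ x₂ y₁ y₂ u₁ u₂ → (k :* a :* x₂ :* y₂) :* u₁ :+ (con (+ 1) :- k :* a :* x₁ :* y₂) :* u₂
                                      := u₂ :+ (k :* (a :* (u₁ :* x₂ :- u₂ :* x₁))) :* y₂) refl k α x₁ x₂ y₁ y₂ u₁ u₂

  detM-reflection : ∀ x y k → detM (reflection x y k) ≈ 1# - k * ⟨ x , y ⟩
  detM-reflection (x₁ , x₂) (y₁ , y₂) k =
    solve 6 (λ k a x₁ x₂ y₁ y₂ → (con (+ 1) :+ k :* a :* x₂ :* y₁) :* (con (+ 1) :- k :* a :* x₁ :* y₂)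
                                  :- (:- (k :* a :* x₁ :* y₁)) :* (k :* a :* x₂ :* y₂)
                                  := con (+ 1) :- k :* (a :* (x₁ :* y₂ :- x₂ :* y₁))) refl k α x₁ x₂ y₁ y₂

  -- When k⟨x , y⟩ = 2 the reflection also satisfies the second equation of condition (c).
  reflection-+ : ∀ x y k u → k * ⟨ x , y ⟩ ≈ two →
                 ((u +U ((k * ⟨ u , x ⟩) ·U y)) +U u) ≈U ((k * ⟨ u , y ⟩) ·U x)
  reflection-+ (x₁ , x₂) (y₁ , y₂) k (u₁ , u₂) k⟨x,y⟩≈2 =
    trans (expand₁ k α x₁ x₂ y₁ y₂ u₁ u₂) (vanish _ u₁) , trans (expand₂ k α x₁ x₂ y₁ y₂ u₁ u₂) (vanish _ u₂)
    where
    open Relation.Binary.Reasoning.Setoid setoid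
    expand₁ : ∀ k a x₁ x₂ y₁ y₂ u₁ u₂ →
      (u₁ + k * (a * (u₁ * x₂ - u₂ * x₁)) * y₁) + u₁ ≈
      k * (a * (u₁ * y₂ - u₂ * y₁)) * x₁ + (two - k * (a * (x₁ * y₂ - x₂ * y₁))) * u₁
    expand₁ = solve 8 (λ k a x₁ x₂ y₁ y₂ u₁ u₂ → (u₁ :+ k :* (a :* (u₁ :* x₂ :- u₂ :* x₁)) :* y₁) :+ u₁
                := k :* (a :* (u₁ :* y₂ :- u₂ :* y₁)) :* x₁ :+ (con (+ 2) :- k :* (a :* (x₁ :* y₂ :- x₂ :* y₁))) :* u₁) refl
    expand₂ : ∀ k a x₁ x₂ y₁ y₂ u₁ u₂ →
      (u₂ + k * (a * (u₁ * x₂ - u₂ * x₁)) * y₂) + u₂ ≈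
      k * (a * (u₁ * y₂ - u₂ * y₁)) * x₂ + (two - k * (a * (x₁ * y₂ - x₂ * y₁))) * u₂
    expand₂ = solve 8 (λ k a x₁ x₂ y₁ y₂ u₁ u₂ → (u₂ :+ k :* (a :* (u₁ :* x₂ :- u₂ :* x₁)) :* y₂) :+ u₂
                := k :* (a :* (u₁ :* y₂ :- u₂ :* y₁)) :* x₂ :+ (con (+ 2) :- k :* (a :* (x₁ :* y₂ :- x₂ :* y₁))) :* u₂) refl
    vanish : ∀ r u → r + (two - k * ⟨ (x₁ , x₂) , (y₁ , y₂) ⟩) * u ≈ r
    vanish r u = begin
      r + (two - k⟨x,y⟩) * u               ≈⟨ +-congˡ (*-congʳ (+-congʳ (sym k⟨x,y⟩≈2))) ⟩
      r + (k⟨x,y⟩ - k⟨x,y⟩) * u            ≈⟨ +-congˡ (*-congʳ (-‿inverseʳ k⟨x,y⟩)) ⟩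
      r + 0# * u                          ≈⟨ +-congˡ (zeroˡ u) ⟩
      r + 0#                              ≈⟨ +-identityʳ r ⟩
      r                                   ∎
      where k⟨x,y⟩ = k * ⟨ (x₁ , x₂) , (y₁ , y₂) ⟩

module BaseChange {c₁ ℓ₁ c₂ ℓ₂} (R : CommutativeRing c₁ ℓ₁) (R₀ : CommutativeRing c₂ ℓ₂)
  (f : CommutativeRing.Carrier R → CommutativeRing.Carrier R₀) (f-surjection : IsRingSurjection R R₀ f) where
  open CommutativeRing R₀
  open IsRingSurjection f-surjection
  open IsRingHomomorphism isHom
  module S = CommutativeRing R
  module L = Matrices R
  module L₀ = Matrices R₀

  φU : L.U → L₀.U
  φU (a , b) = f a , f b

  φM : L.M → L₀.M
  φM = mapMat f

  f-cong : ∀ {a b} → a S.≈ b → f a ≈ f b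
  f-cong = ⟦⟧-cong

  φU-cong : ∀ {u v} → u L.≈U v → φU u L₀.≈U φU v
  φU-cong (p , q) = f-cong p , f-cong q

  φM-cong : ∀ {A B} → A L.≈M B → φM A L₀.≈M φM B
  φM-cong (p , q , r , s) = f-cong p , f-cong q , f-cong r , f-cong s

  f-− : ∀ a b → f (a L.− b) ≈ f a L₀.− f b
  f-− a b = trans (+-homo a (S.- b)) (+-congˡ (-‿homo b))

  φU-app : ∀ h u → φU (L.app h u) L₀.≈U L₀.app (φM h) (φU u)
  φU-app (mat a b c d) (x , y) =
    trans (+-homo _ _) (+-cong (*-homo a x) (*-homo b y)) ,
    trans (+-homo _ _) (+-cong (*-homo c x) (*-homo d y))

  φM-∙ : ∀ A B → φM (A L.∙ B) L₀.≈M (φM A L₀.∙ φM B)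
  φM-∙ (mat a b c d) (mat a′ b′ c′ d′) = entry , entry , entry , entry
    where
    entry : ∀ {p q r s} → f (p S.* q S.+ r S.* s) ≈ f p * f q + f r * f s
    entry = trans (+-homo _ _) (+-cong (*-homo _ _) (*-homo _ _))

  f-det : ∀ u v → f (L.det u v) ≈ L₀.det (φU u) (φU v)
  f-det (x₁ , x₂) (y₁ , y₂) = trans (f-− _ _) (+-cong (*-homo _ _) (-‿cong (*-homo _ _)))

  f-detM : ∀ A → f (L.detM A) ≈ L₀.detM (φM A)
  f-detM (mat a b c d) = trans (f-− _ _) (+-cong (*-homo _ _) (-‿cong (*-homo _ _)))

  φU-negU : ∀ u → φU (L.negU u) L₀.≈U L₀.negU (φU u)
  φU-negU (a , b) = -‿homo a , -‿homo b

  φU-+U : ∀ u v → φU (u L.+U v) L₀.≈U (φU u L₀.+U φU v)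
  φU-+U (a , b) (a′ , b′) = +-homo a a′ , +-homo b b′

  φU-−U : ∀ u v → φU (u L.−U v) L₀.≈U (φU u L₀.−U φU v)
  φU-−U u v = L₀.≈U-trans (φU-+U u (L.negU v)) (L₀.+U-cong L₀.≈U-refl (φU-negU v))

  φU-·U : ∀ r u → φU (r L.·U u) L₀.≈U (f r L₀.·U φU u)
  φU-·U r (a , b) = *-homo r a , *-homo r b

  f-wval : ∀ w → f (L.wval w) ≈ L₀.wval w
  f-wval w1 = 1#-homo
  f-wval w2 = trans (+-homo _ _) (+-cong 1#-homo 1#-homo)

  φM-I : φM L.I L₀.≈M L₀.I
  φM-I = 1#-homo , 0#-homo , 0#-homo , 1#-homo

  φM-negI : φM L.negI L₀.≈M L₀.negI
  φM-negI = trans (-‿homo _) (-‿cong 1#-homo) , 0#-homo , 0#-homo , trans (-‿homo _) (-‿cong 1#-homo)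

  f-unit : ∀ {a} → a S.≈ S.1# → f a ≈ 1#
  f-unit a≈1 = trans (f-cong a≈1) 1#-homo

  liftU : ∀ u₀ → Σ L.U λ u → φU u L₀.≈U u₀
  liftU (a , b) = (proj₁ (surj a) , proj₁ (surj b)) , proj₂ (surj a) , proj₂ (surj b)

  module Reduction {g} (α : S.Carrier) (C : L.M) (G₀ : L₀.M → Set g) where
    G : L.M → Set (ℓ₁ Level.⊔ g)
    G = preimage R R₀ f G₀
    module X = XiConstruction R α C G
    module X₀ = XiConstruction R₀ (f α) (φM C) G₀
    module Γ = Geodesics R α C G
    module Γ₀ = Geodesics R₀ (f α) (φM C) G₀

    φT : X.Tri → X₀.Tri
    φT (X.tri x y z w) = X₀.tri (φU x) (φU y) (φU z) w

    f-⟨⟩ : ∀ u v → f X.⟨ u , v ⟩ ≈ X₀.⟨ φU u , φU v ⟩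
    f-⟨⟩ u v = trans (*-homo _ _) (*-congˡ (f-det u v))

    φT-TEq : ∀ {t s} → X.TEq t s → X₀.TEq (φT t) (φT s)
    φT-TEq {X.tri _ _ _ _} {X.tri _ _ _ _} (p , q , r , e) = φU-cong p , φU-cong q , φU-cong r , e

    φT-ρ : ∀ t → X₀.TEq (φT (X.ρ t)) (X₀.ρ (φT t))
    φT-ρ (X.tri x y z w) =
      L₀.≈U-refl ,
      L₀.≈U-trans (φU-−U z _) (L₀.−U-cong L₀.≈U-refl (L₀.≈U-trans (φU-·U _ x) (L₀.·U-cong (f-wval (comp w)) L₀.≈U-refl))) ,
      L₀.≈U-refl , ≡.refl

    φT-iterρ² : ∀ n t → X₀.TEq (φT (iter X.ρ² n t)) (iter X₀.ρ² n (φT t))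
    φT-iterρ² zero    t = Γ₀.TEq-refl
    φT-iterρ² (suc n) t =
      Γ₀.TEq-trans (φT-ρ (X.ρ (iter X.ρ² n t))) (Γ₀.ρ-cong (Γ₀.TEq-trans (φT-ρ (iter X.ρ² n t)) (Γ₀.ρ-cong (φT-iterρ² n t))))

    φT-actT : ∀ h t → X₀.TEq (φT (X.actT h t)) (X₀.actT (φM h) (φT t))
    φT-actT h (X.tri x y z w) = φU-app h x , φU-app h y , φU-app h z , ≡.refl

    φT-Orb : ∀ {a b} → X.Orb a b → X₀.Orb (φT a) (φT b)
    φT-Orb {a} (n , p) = n , Γ₀.TEq-trans (Γ₀.TEq-sym (φT-iterρ² n a)) (φT-TEq p)

    φT-Orb-actT : ∀ h {a b} → X.Orb (X.actT h a) b → X₀.Orb (X₀.actT (φM h) (φT a)) (φT b)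
    φT-Orb-actT h {a} ha~b = Γ₀.Orb-TEqˡ (Γ₀.TEq-sym (φT-actT h a)) (φT-Orb ha~b)

    φT-InT : ∀ t → X.InT t → X₀.InT (φT t)
    φT-InT (X.tri x y z w) (_ , _ , _ , ⟨x,z⟩≈1 , _ , b) =
      Γ₀.mkInT {w = w} (trans (sym (f-⟨⟩ x z)) (f-unit ⟨x,z⟩≈1))
        (L₀.≈U-trans (L₀.≈U-sym (φU-+U x y)) (L₀.≈U-trans (φU-cong b) (L₀.≈U-trans (φU-·U _ z) (L₀.·U-cong (f-wval w) L₀.≈U-refl))))

    φU-C∘h : ∀ h u → φU (L.app C (L.app h u)) L₀.≈U L₀.app (φM C) (L₀.app (φM h) (φU u))
    φU-C∘h h u = L₀.≈U-trans (φU-app C _) (L₀.app-congʳ (φM C) (φU-app h u))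

    f-coefficient : ∀ w u v {u₀} → φU u L₀.≈U u₀ → f (L.wval w S.* X.⟨ u , v ⟩) ≈ L₀.wval w * X₀.⟨ u₀ , φU v ⟩
    f-coefficient w u v u≈u₀ = trans (*-homo _ _) (*-cong (f-wval w) (trans (f-⟨⟩ u v) (*-congˡ (L₀.det-cong u≈u₀ L₀.≈U-refl))))

    φT-CondC : ∀ t → X.CondC t → X₀.CondC (φT t)
    φT-CondC (X.tri x y z w) (h , (_ , φh∈G₀) , eqs) = φM h , φh∈G₀ , λ u₀ →
      let (u , u≈u₀) = liftU u₀
          k = comp w
          C₀h₀u₀≈ : L₀.app (φM C) (L₀.app (φM h) u₀) L₀.≈U φU (L.app C (L.app h u))
          C₀h₀u₀≈ = L₀.≈U-trans (L₀.app-congʳ (φM C) (L₀.app-congʳ (φM h) (L₀.≈U-sym u≈u₀))) (L₀.≈U-sym (φU-C∘h h u))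
      in (begin
            L₀.app (φM C) (L₀.app (φM h) u₀) L₀.−U u₀     ≈⟨ L₀.−U-cong C₀h₀u₀≈ (L₀.≈U-sym u≈u₀) ⟩
            φU (L.app C (L.app h u)) L₀.−U φU u           ≈⟨ φU-−U _ u ⟨
            φU (L.app C (L.app h u) L.−U u)               ≈⟨ φU-cong (proj₁ (eqs u)) ⟩
            φU ((L.wval k S.* X.⟨ u , x ⟩) L.·U y)        ≈⟨ φU-·U _ y ⟩
            f (L.wval k S.* X.⟨ u , x ⟩) L₀.·U φU y       ≈⟨ L₀.·U-cong (f-coefficient k u x u≈u₀) L₀.≈U-refl ⟩
            (L₀.wval k * X₀.⟨ u₀ , φU x ⟩) L₀.·U φU y     ∎) ,
         (begin
            L₀.app (φM C) (L₀.app (φM h) u₀) L₀.+U u₀     ≈⟨ L₀.+U-cong C₀h₀u₀≈ (L₀.≈U-sym u≈u₀) ⟩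
            φU (L.app C (L.app h u)) L₀.+U φU u           ≈⟨ φU-+U _ u ⟨
            φU (L.app C (L.app h u) L.+U u)               ≈⟨ φU-cong (proj₂ (eqs u)) ⟩
            φU ((L.wval k S.* X.⟨ u , y ⟩) L.·U x)        ≈⟨ φU-·U _ x ⟩
            f (L.wval k S.* X.⟨ u , y ⟩) L₀.·U φU x       ≈⟨ L₀.·U-cong (f-coefficient k u y u≈u₀) L₀.≈U-refl ⟩
            (L₀.wval k * X₀.⟨ u₀ , φU y ⟩) L₀.·U φU x     ∎)
      where open L₀.≈U-Reasoning

    φGeo : X.Geo → X₀.Geo
    φGeo (X.geo t t∈𝒯 t⊨c) = X₀.geo (φT t) (φT-InT t t∈𝒯) (φT-CondC t t⊨c)

    φEll : X.Ell → X₀.Ell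
    φEll (X.ell a b ρa~b) = X₀.ell (φGeo a) (φGeo b) (Γ₀.Orb-TEqˡ (Γ₀.TEq-sym (φT-ρ (X.Geo.tr a))) (φT-Orb ρa~b))

    φEll-Contains : ∀ {γ p} → X.Contains γ p → X₀.Contains (φGeo γ) (φEll p)
    φEll-Contains {X.geo _ _ _} {X.ell (X.geo _ _ _) (X.geo _ _ _) _} (inj₁ a~γ) = inj₁ (φT-Orb a~γ)
    φEll-Contains {X.geo _ _ _} {X.ell (X.geo _ _ _) (X.geo _ _ _) _} (inj₂ b~γ) = inj₂ (φT-Orb b~γ)

    φEll-PEq : ∀ h {p q} → X.PEq h p q → X₀.PEq (φM h) (φEll p) (φEll q)
    φEll-PEq h {X.ell (X.geo _ _ _) (X.geo _ _ _) _} {X.ell (X.geo _ _ _) (X.geo _ _ _) _} (inj₁ (o , o′)) =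
      inj₁ (φT-Orb-actT h o , φT-Orb-actT h o′)
    φEll-PEq h {X.ell (X.geo _ _ _) (X.geo _ _ _) _} {X.ell (X.geo _ _ _) (X.geo _ _ _) _} (inj₂ (o , o′)) =
      inj₂ (φT-Orb-actT h o , φT-Orb-actT h o′)

    φU-≈± : ∀ {u v} → u L.≈± v → φU u L₀.≈± φU v
    φU-≈± (inj₁ u≈v)  = inj₁ (φU-cong u≈v)
    φU-≈± (inj₂ u≈-v) = inj₂ (L₀.≈U-trans (φU-cong u≈-v) (φU-negU _))

    φU-IsParabolic : ∀ {u} → X.IsParabolic u → X₀.IsParabolic (φU u)
    φU-IsParabolic {u} ((v , s , unit) , h , ((_ , φh∈G₀) , hᶜh≈I) , Chu≈u) =
      (φU v , f s , trans (*-congʳ (sym (f-det u v))) (trans (sym (*-homo _ _)) (f-unit unit))) ,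
      φM h , (φh∈G₀ , φhᶜφh≈I) ,
      L₀.≈U-trans (L₀.≈U-sym (φU-C∘h h u)) (φU-cong Chu≈u)
      where
      open L₀.≈M-Reasoning
      φhᶜφh≈I : (X₀._ᶜ (φM h) L₀.∙ φM h) L₀.≈M L₀.I
      φhᶜφh≈I = begin
        (φM C L₀.∙ (φM h L₀.∙ φM C)) L₀.∙ φM h    ≈⟨ L₀.∙-cong (L₀.∙-cong L₀.≈M-refl (φM-∙ h C)) L₀.≈M-refl ⟨
        (φM C L₀.∙ φM (h L.∙ C)) L₀.∙ φM h        ≈⟨ L₀.∙-cong (φM-∙ C _) L₀.≈M-refl ⟨
        φM (C L.∙ (h L.∙ C)) L₀.∙ φM h            ≈⟨ φM-∙ _ h ⟨
        φM (X._ᶜ h L.∙ h)                         ≈⟨ φM-cong hᶜh≈I ⟩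
        φM L.I                                    ≈⟨ φM-I ⟩
        L₀.I                                      ∎

    φT-endpt : ∀ t s → X₀.endpt (φT t) s ≡ φU (X.endpt t s)
    φT-endpt (X.tri _ _ _ _) true  = ≡.refl
    φT-endpt (X.tri _ _ _ _) false = ≡.refl

module Lifting {c₁ ℓ₁ c₂ ℓ₂ g} (R : CommutativeRing c₁ ℓ₁) (R₀ : CommutativeRing c₂ ℓ₂)
  (f : CommutativeRing.Carrier R → CommutativeRing.Carrier R₀)
  (f-surjection : IsRingSurjection R R₀ f) (SL₂-surj : SL₂-surjective R R₀ f)
  (α : CommutativeRing.Carrier R) (α-unit : LinAlg.IsUnit R α)
  (C : LinAlg.M R) (C²≈I : LinAlg._≈M_ R (LinAlg._∙_ R C C) (LinAlg.I R))
  (detC≈-1 : CommutativeRing._≈_ R (LinAlg.detM R C) (CommutativeRing.-_ R (CommutativeRing.1# R)))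
  (G₀ : LinAlg.M R₀ → Set g) (G₀-subgroup : LinAlg.IsSubgroupOfSL R₀ G₀) (G₀-negI : G₀ (LinAlg.negI R₀)) where
  open CommutativeRing R₀
  open IsRingSurjection f-surjection
  open IsRingHomomorphism isHom
  open BaseChange R R₀ f f-surjection
  open Reduction α C G₀
  open L₀.IsSubgroupOfSL G₀-subgroup

  G-∙ : ∀ {A B} → G A → G B → G (A L.∙ B)
  G-∙ {A} {B} (detA≈1 , φA∈G₀) (detB≈1 , φB∈G₀) =
    S.trans (L.detM-∙ A B) (S.trans (S.*-cong detA≈1 detB≈1) (S.*-identityˡ _)) ,
    resp (L₀.≈M-sym (φM-∙ A B)) (closed-∙ φA∈G₀ φB∈G₀)

  G-negI : G L.negI
  G-negI = L.detM-negI , resp (L₀.≈M-sym φM-negI) G₀-negI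

  G₀-inverse : ∀ {A} → G₀ A → Σ L₀.M λ B → G₀ B × ((B L₀.∙ A) L₀.≈M L₀.I)
  G₀-inverse {A} A∈G₀ with closed-⁻¹ A∈G₀
  ... | B , B∈G₀ , AB≈I = B , B∈G₀ , L₀.rightInverse⇒leftInverse A B (⊆SL A∈G₀) AB≈I

  module Neg = Γ.UnderNegation G-∙ G-negI
  module Neg₀ = Γ₀.UnderNegation closed-∙ G₀-negI
  module Orbits₀ = Γ₀.OrbitRelations closed-∙ G₀-inverse

  InKernel : L.M → Set (ℓ₁ Level.⊔ ℓ₂)
  InKernel k = (L.detM k S.≈ S.1#) × (φM k L₀.≈M L₀.I)

  InKernel⇒G : ∀ {k} → InKernel k → G k
  InKernel⇒G (det≈1 , φk≈I) = det≈1 , resp (L₀.≈M-sym φk≈I) has-I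

  liftG : ∀ {h₀} → G₀ h₀ → Σ L.M λ h → G h × (φM h L₀.≈M h₀)
  liftG h₀∈G₀ with SL₂-surj _ (⊆SL h₀∈G₀)
  ... | h , deth≈1 , φh≈h₀ = h , (deth≈1 , resp (L₀.≈M-sym φh≈h₀) h₀∈G₀) , φh≈h₀

  liftUnimodular : ∀ {u₀ v₀} → L₀.det u₀ v₀ ≈ 1# →
                   Σ L.U λ u → Σ L.U λ v → (L.det u v S.≈ S.1#) × (φU u L₀.≈U u₀) × (φU v L₀.≈U v₀)
  liftUnimodular {u₀} {v₀} det≈1 with SL₂-surj (L₀.col u₀ v₀) (trans (L₀.detM-col u₀ v₀) det≈1)
  ... | A , detA≈1 , (p , q , r , s) = L.column₁ A , L.column₂ A , S.trans (S.sym (L.detM-col _ _)) detA≈1 , (p , r) , (q , s)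

  unimodularTransport : ∀ {x z x′ z′} → L.det x z S.≈ S.1# → L.det x′ z′ S.≈ S.1# →
                         φU x L₀.≈U φU x′ → φU z L₀.≈U φU z′ →
                         Σ L.M λ k → InKernel k × (L.app k x L.≈U x′) × (L.app k z L.≈U z′)
  unimodularTransport {x} {z} {x′} {z′} det≈1 det′≈1 x≡x′ z≡z′ = k , (detk≈1 , φk≈I) , kx≈x′ , kz≈z′
    where
    k = L.sending x z x′ z′
    detk≈1 = S.trans (L.detM-sending x z x′ z′) (S.trans (S.*-cong det′≈1 det≈1) (S.*-identityˡ S.1#))
    kx≈x′ = L.app-sending₁ x′ z′ det≈1
    kz≈z′ = L.app-sending₂ x′ z′ det≈1
    φk-fixes : ∀ {v v′} → L.app k v L.≈U v′ → φU v L₀.≈U φU v′ → L₀.app (φM k) (φU v) L₀.≈U L₀.app L₀.I (φU v)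
    φk-fixes kv≈v′ v≡v′ = L₀.≈U-trans (L₀.≈U-sym (φU-app k _)) (L₀.≈U-trans (φU-cong kv≈v′)
                            (L₀.≈U-trans (L₀.≈U-sym v≡v′) (L₀.≈U-sym (L₀.app-I _))))
    φk≈I : φM k L₀.≈M L₀.I
    φk≈I = L₀.≈M-fromBasis {s = 1#} (trans (*-identityˡ _) (trans (sym (f-det x z)) (f-unit det≈1)))
                          (φk-fixes kx≈x′ x≡x′) (φk-fixes kz≈z′ z≡z′)

  -- Over R₀ any two unimodular partners of φ b differ by a multiple of φ b (Cramer's rule), and that multiple lifts.
  matchingPartner : ∀ {a a′ b b′} → L.det a a′ S.≈ S.1# → L.det b b′ S.≈ S.1# → φU a L₀.≈U φU b →
                    Σ L.U λ b″ → (L.det b b″ S.≈ S.1#) × (φU a′ L₀.≈U φU b″)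
  matchingPartner {a} {a′} {b} {b′} det-aa′≈1 det-bb′≈1 a≡b =
    b′ L.+U (t L.·U b) , S.trans (L.det-+·ʳ t b b′) det-bb′≈1 , a′≡b″
    where
    t = L.det a′ b′
    det₀-bb′≈1 : L₀.det (φU b) (φU b′) ≈ 1#
    det₀-bb′≈1 = trans (sym (f-det b b′)) (f-unit det-bb′≈1)
    det₀-ba′≈1 : L₀.det (φU b) (φU a′) ≈ 1#
    det₀-ba′≈1 = trans (L₀.det-cong (L₀.≈U-sym a≡b) L₀.≈U-refl) (trans (sym (f-det a a′)) (f-unit det-aa′≈1))
    open L₀.≈U-Reasoning
    a′≡b″ : φU a′ L₀.≈U φU (b′ L.+U (t L.·U b))
    a′≡b″ = begin
      φU a′                                                ≈⟨ L₀.·U-identityˡ _ ⟨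
      1# L₀.·U φU a′                                       ≈⟨ L₀.·U-cong det₀-bb′≈1 L₀.≈U-refl ⟨
      L₀.det (φU b) (φU b′) L₀.·U φU a′                    ≈⟨ L₀.cramer (φU b) (φU b′) (φU a′) ⟩
      (L₀.det (φU a′) (φU b′) L₀.·U φU b) L₀.+U (L₀.det (φU b) (φU a′) L₀.·U φU b′)
                                                           ≈⟨ L₀.+U-cong (L₀.·U-cong (sym (f-det a′ b′)) L₀.≈U-refl)
                                                                         (L₀.≈U-trans (L₀.·U-cong det₀-ba′≈1 L₀.≈U-refl) (L₀.·U-identityˡ _)) ⟩
      (f t L₀.·U φU b) L₀.+U φU b′                         ≈⟨ L₀.+U-comm (f t L₀.·U φU b) (φU b′) ⟩
      φU b′ L₀.+U (f t L₀.·U φU b)                         ≈⟨ L₀.≈U-trans (φU-+U b′ _) (L₀.+U-cong L₀.≈U-refl (φU-·U t b)) ⟨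
      φU (b′ L.+U (t L.·U b))                              ∎

  basisVectorTransport : ∀ {a b} → X.IsBasisVector a → X.IsBasisVector b → φU a L₀.≈U φU b →
                          Σ L.M λ k → InKernel k × (L.app k a L.≈U b)
  basisVectorTransport a-basis b-basis a≡b =
    let a′ , det-aa′≈1 = Γ.unimodularPartner a-basis
        b′ , det-bb′≈1 = Γ.unimodularPartner b-basis
        b″ , det-bb″≈1 , a′≡b″ = matchingPartner det-aa′≈1 det-bb′≈1 a≡b
        k , k∈ker , ka≈b , _ = unimodularTransport det-aa′≈1 det-bb″≈1 a≡b a′≡b″
    in k , k∈ker , ka≈b

  α⁻¹ = proj₁ α-unit

  α⁻¹*α≈1 : α⁻¹ S.* α S.≈ S.1#
  α⁻¹*α≈1 = S.trans (S.*-comm α⁻¹ α) (proj₂ α-unit)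

  tripleTransport : ∀ t t′ → X.InT t → X.InT t′ → X₀.TEq (φT t) (φT t′) →
                     Σ L.M λ k → InKernel k × X.TEq (X.actT k t) t′
  tripleTransport (X.tri x y z w) (X.tri x′ y′ z′ w) (_ , _ , _ , ⟨x,z⟩≈1 , _ , b) (_ , _ , _ , ⟨x′,z′⟩≈1 , _ , b′)
                   (x≡x′ , _ , z≡z′ , ≡.refl) =
    let k , k∈ker , kx≈x′ , kαz≈αz′ = unimodularTransport (unimodular x z ⟨x,z⟩≈1) (unimodular x′ z′ ⟨x′,z′⟩≈1) x≡x′ αz≡αz′
        kz≈z′ = L.≈U-trans (L.≈U-sym (L.·U-unit _ α⁻¹*α≈1))
                (L.≈U-trans (L.·U-cong S.refl (L.≈U-trans (L.≈U-sym (L.app-· k α z)) kαz≈αz′)) (L.·U-unit z′ α⁻¹*α≈1))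
        ky≈y′ = L.≈U-trans (L.app-congʳ k (L.y≈v−x b)) (L.≈U-trans (L.app-− k _ x)
                (L.≈U-trans (L.−U-cong (L.≈U-trans (L.app-· k _ z) (L.·U-cong S.refl kz≈z′)) kx≈x′) (L.≈U-sym (L.y≈v−x b′))))
    in k , k∈ker , kx≈x′ , ky≈y′ , kz≈z′ , ≡.refl
    where
    unimodular : ∀ x z → X.⟨ x , z ⟩ S.≈ S.1# → L.det x (α L.·U z) S.≈ S.1#
    unimodular x z ⟨x,z⟩≈1 = S.trans (L.det-·ʳ α x z) ⟨x,z⟩≈1
    αz≡αz′ : φU (α L.·U z) L₀.≈U φU (α L.·U z′)
    αz≡αz′ = L₀.≈U-trans (φU-·U α z) (L₀.≈U-trans (L₀.·U-cong refl z≡z′) (L₀.≈U-sym (φU-·U α z′)))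

  liftTri : ∀ t₀ → X₀.InT t₀ → Σ X.Tri λ t → X.InT t × X₀.TEq (φT t) t₀
  liftTri (X₀.tri x₀ y₀ z₀ w) (_ , _ , _ , ⟨x₀,z₀⟩≈1 , _ , b₀) =
    let x , z′ , det-xz′≈1 , x≡x₀ , z′≡αz₀ = liftUnimodular (trans (L₀.det-·ʳ (f α) x₀ z₀) ⟨x₀,z₀⟩≈1)
        z = α⁻¹ L.·U z′
        ⟨x,z⟩≈1 = S.trans (S.*-congˡ (S.trans (L.det-·ʳ α⁻¹ x z′) (S.trans (S.*-congˡ det-xz′≈1) (S.*-identityʳ α⁻¹))))
                          (proj₂ α-unit)
        z≡z₀ = L₀.≈U-trans (φU-·U α⁻¹ z′) (L₀.≈U-trans (L₀.·U-cong refl z′≡αz₀) (L₀.·U-unit z₀ fα⁻¹*fα≈1))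
        y≡y₀ = L₀.≈U-trans (φU-−U _ x) (L₀.≈U-trans (L₀.−U-cong (L₀.≈U-trans (φU-·U _ z) (L₀.·U-cong (f-wval w) z≡z₀)) x≡x₀)
                                                    (L₀.≈U-sym (L₀.y≈v−x b₀)))
    in X.tri x ((L.wval w L.·U z) L.−U x) z w , Γ.mkInT {w = w} ⟨x,z⟩≈1 (L.x+[v−x]≈v x _) , x≡x₀ , y≡y₀ , z≡z₀ , ≡.refl
    where
    fα⁻¹*fα≈1 : f α⁻¹ * f α ≈ 1#
    fα⁻¹*fα≈1 = trans (sym (*-homo α⁻¹ α)) (f-unit α⁻¹*α≈1)

  C₀²≈I : (φM C L₀.∙ φM C) L₀.≈M L₀.I
  C₀²≈I = L₀.≈M-trans (L₀.≈M-sym (φM-∙ C C)) (L₀.≈M-trans (φM-cong C²≈I) φM-I)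

  liftCondC : ∀ t → X.InT t → X₀.CondC (φT t) → X.CondC t
  liftCondC (X.tri x y z w) t∈𝒯 (h₀ , h₀∈G₀ , eqs₀) = C L.∙ E , (detCE≈1 , resp h₀≈φ[CE] h₀∈G₀) , λ u → eq₁ u , eq₂ u
    where
    k = L.wval (comp w)
    E = Γ.reflection x y k
    k⟨x,y⟩≈2 : k S.* X.⟨ x , y ⟩ S.≈ L.two
    k⟨x,y⟩≈2 = S.trans (S.*-congˡ (Γ.⟨x,y⟩≈w x y z w t∈𝒯)) (Γ.wval-comp-* w)
    CCE≈E : ∀ u → L.app C (L.app (C L.∙ E) u) L.≈U L.app E u
    CCE≈E u = L.≈U-trans (L.app-congʳ C (L.app-∙ C E u)) (L.app-involution C²≈I _)
    eq₁ : ∀ u → (L.app C (L.app (C L.∙ E) u) L.−U u) L.≈U ((k S.* X.⟨ u , x ⟩) L.·U y)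
    eq₁ u = L.≈U-trans (L.−U-cong (L.≈U-trans (CCE≈E u) (Γ.app-reflection x y k u)) L.≈U-refl) (L.[u+v]−u≈v u _)
    eq₂ : ∀ u → (L.app C (L.app (C L.∙ E) u) L.+U u) L.≈U ((k S.* X.⟨ u , y ⟩) L.·U x)
    eq₂ u = L.≈U-trans (L.+U-cong (L.≈U-trans (CCE≈E u) (Γ.app-reflection x y k u)) L.≈U-refl) (Γ.reflection-+ x y k u k⟨x,y⟩≈2)
    detCE≈1 : L.detM (C L.∙ E) S.≈ S.1#
    detCE≈1 = S.trans (L.detM-∙ C E) (S.trans (S.*-cong detC≈-1 (S.trans (Γ.detM-reflection x y k) (S.+-congˡ (S.-‿cong k⟨x,y⟩≈2))))
                (IntegerCoefficients.solve R 0 (:- con (+ 1) :* (con (+ 1) :- con (+ 2)) := con (+ 1)) S.refl))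
      where open IntegerCoefficients R using (_:=_; _:*_; _:-_; :-_; con)
    h₀≈φ[CE] : h₀ L₀.≈M φM (C L.∙ E)
    h₀≈φ[CE] = L₀.≈M-fromApp λ u₀ →
      let u , u≡u₀ = liftU u₀
          open L₀.≈U-Reasoning
      in begin
        L₀.app h₀ u₀                                              ≈⟨ L₀.app-involution C₀²≈I _ ⟨
        L₀.app (φM C) (L₀.app (φM C) (L₀.app h₀ u₀))              ≈⟨ L₀.app-congʳ (φM C) (L₀.−U⇒+U (proj₁ (eqs₀ u₀))) ⟩
        L₀.app (φM C) (u₀ L₀.+U ((L₀.wval (comp w) * X₀.⟨ u₀ , φU x ⟩) L₀.·U φU y))
                                                                  ≈⟨ L₀.app-congʳ (φM C) (L₀.+U-cong (L₀.≈U-sym u≡u₀)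
                                                                       (L₀.·U-cong (sym (f-coefficient (comp w) u x u≡u₀)) L₀.≈U-refl)) ⟩
        L₀.app (φM C) (φU u L₀.+U (f (k S.* X.⟨ u , x ⟩) L₀.·U φU y))
                                                                  ≈⟨ L₀.app-congʳ (φM C) (L₀.≈U-trans (L₀.+U-cong L₀.≈U-refl (L₀.≈U-sym (φU-·U _ y)))
                                                                                                      (L₀.≈U-sym (φU-+U u _))) ⟩
        L₀.app (φM C) (φU (u L.+U ((k S.* X.⟨ u , x ⟩) L.·U y)))  ≈⟨ L₀.app-congʳ (φM C) (φU-cong (L.≈U-sym (Γ.app-reflection x y k u))) ⟩
        L₀.app (φM C) (φU (L.app E u))                            ≈⟨ φU-app C _ ⟨
        φU (L.app C (L.app E u))                                  ≈⟨ φU-cong (L.app-∙ C E u) ⟨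
        φU (L.app (C L.∙ E) u)                                    ≈⟨ φU-app (C L.∙ E) u ⟩
        L₀.app (φM (C L.∙ E)) (φU u)                              ≈⟨ L₀.app-congʳ (φM (C L.∙ E)) u≡u₀ ⟩
        L₀.app (φM (C L.∙ E)) u₀                                  ∎

  detC₀≈-1 : L₀.detM (φM C) ≈ - 1#
  detC₀≈-1 = trans (sym (f-detM C)) (trans (f-cong detC≈-1) (trans (-‿homo _) (-‿cong 1#-homo)))

  C₀h₀-partner : ∀ {u a h₀} → L₀.det (φU u) (φU a) ≈ 1# → L₀.detM h₀ ≈ 1# →
           L₀.app (φM C) (L₀.app h₀ (φU u)) L₀.≈U φU u →
           L₀.app (φM C) (L₀.app h₀ (φU a)) L₀.≈U ((L₀.det (L₀.app (φM C) (L₀.app h₀ (φU a))) (φU a) L₀.·U φU u) L₀.−U φU a)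
  C₀h₀-partner {u} {a} {h₀} det₀-ua≈1 deth₀≈1 C₀h₀u≈u = begin
    V                                                        ≈⟨ L₀.·U-identityˡ V ⟨
    1# L₀.·U V                                               ≈⟨ L₀.·U-cong det₀-ua≈1 L₀.≈U-refl ⟨
    L₀.det (φU u) (φU a) L₀.·U V                             ≈⟨ L₀.cramer (φU u) (φU a) V ⟩
    (L₀.det V (φU a) L₀.·U φU u) L₀.+U (L₀.det (φU u) V L₀.·U φU a)
                                                             ≈⟨ L₀.+U-cong L₀.≈U-refl (L₀.≈U-trans (L₀.·U-cong det-uV≈-1 L₀.≈U-refl) (L₀.·U-neg1 (φU a))) ⟩
    (L₀.det V (φU a) L₀.·U φU u) L₀.−U φU a                  ∎
    where
    open L₀.≈U-Reasoning
    V = L₀.app (φM C) (L₀.app h₀ (φU a))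
    det-uV≈-1 : L₀.det (φU u) V ≈ - 1#
    det-uV≈-1 = trans (L₀.det-cong (L₀.≈U-sym C₀h₀u≈u) L₀.≈U-refl)
                (trans (L₀.det-app (φM C) _ _) (trans (*-congˡ (L₀.det-app h₀ _ _))
                (trans (*-cong detC₀≈-1 (trans (*-cong deth₀≈1 det₀-ua≈1) (*-identityˡ 1#))) (*-identityʳ _))))

  liftParabolicWitness : ∀ {u a} → L.det u a S.≈ S.1# → X₀.IsParabolic (φU u) →
                         Σ L.M λ h → X.Admissible h × (L.app C (L.app h u) L.≈U u)
  liftParabolicWitness {u} {a} det-ua≈1 (_ , h₀ , (h₀∈G₀ , _) , C₀h₀u≈u) =
    C L.∙ M′ , (h∈G , Γ.[C∙A]ᶜ∙[C∙A]≈I C²≈I (L.mirror-involutive c det-ua≈1)) , Chu≈u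
    where
    det₀-ua≈1 : L₀.det (φU u) (φU a) ≈ 1#
    det₀-ua≈1 = trans (sym (f-det u a)) (f-unit det-ua≈1)
    c₀ = L₀.det (L₀.app (φM C) (L₀.app h₀ (φU a))) (φU a)
    c = proj₁ (surj c₀)
    M′ = L.mirror u a c
    h = C L.∙ M′
    deth≈1 : L.detM h S.≈ S.1#
    deth≈1 = S.trans (L.detM-∙ C M′) (S.trans (S.*-cong detC≈-1 (L.detM-mirror c det-ua≈1))
               (IntegerCoefficients.solve R 0 (:- con (+ 1) :* :- con (+ 1) := con (+ 1)) S.refl))
      where open IntegerCoefficients R using (_:=_; _:*_; :-_; con)
    φhv≈ : ∀ v → L₀.app (φM h) (φU v) L₀.≈U L₀.app (φM C) (φU (L.app M′ v))
    φhv≈ v = L₀.≈U-trans (L₀.≈U-sym (φU-app h v)) (L₀.≈U-trans (φU-cong (L.app-∙ C M′ v)) (φU-app C _))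
    h₀-via-C₀ : ∀ {v₀ w₀} → L₀.app (φM C) (L₀.app h₀ v₀) L₀.≈U w₀ → L₀.app (φM C) w₀ L₀.≈U L₀.app h₀ v₀
    h₀-via-C₀ C₀h₀v≈w = L₀.≈U-trans (L₀.app-congʳ (φM C) (L₀.≈U-sym C₀h₀v≈w)) (L₀.app-involution C₀²≈I _)
    φM′a≈ : φU (L.app M′ a) L₀.≈U ((c₀ L₀.·U φU u) L₀.−U φU a)
    φM′a≈ = L₀.≈U-trans (φU-cong (L.app-mirror₂ c det-ua≈1))
            (L₀.≈U-trans (φU-−U _ a) (L₀.−U-cong (L₀.≈U-trans (φU-·U c u) (L₀.·U-cong (proj₂ (surj c₀)) L₀.≈U-refl)) L₀.≈U-refl))
    φh≈h₀ : φM h L₀.≈M h₀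
    φh≈h₀ = L₀.≈M-fromBasis {s = 1#} (trans (*-identityˡ _) det₀-ua≈1)
      (L₀.≈U-trans (φhv≈ u) (L₀.≈U-trans (L₀.app-congʳ (φM C) (φU-cong (L.app-mirror₁ c det-ua≈1))) (h₀-via-C₀ C₀h₀u≈u)))
      (L₀.≈U-trans (φhv≈ a) (L₀.≈U-trans (L₀.app-congʳ (φM C) φM′a≈)
                   (h₀-via-C₀ (C₀h₀-partner {u} {a} {h₀} det₀-ua≈1 (⊆SL h₀∈G₀) C₀h₀u≈u))))
    h∈G : G h
    h∈G = deth≈1 , resp (L₀.≈M-sym φh≈h₀) h₀∈G₀
    Chu≈u : L.app C (L.app h u) L.≈U u
    Chu≈u = L.≈U-trans (L.app-congʳ C (L.app-∙ C M′ u)) (L.≈U-trans (L.app-involution C²≈I _) (L.app-mirror₁ c det-ua≈1))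

  liftParabolic : ∀ {u} → X.IsBasisVector u → X₀.IsParabolic (φU u) → X.IsParabolic u
  liftParabolic u-basis φu-parabolic = u-basis , liftParabolicWitness (proj₂ (Γ.unimodularPartner u-basis)) φu-parabolic

  liftBasisVector : ∀ {u₀} → X₀.IsBasisVector u₀ → Σ L.U λ u → X.IsBasisVector u × (φU u L₀.≈U u₀)
  liftBasisVector u₀-basis =
    let v₀ , det-u₀v₀≈1 = Γ₀.unimodularPartner u₀-basis
        u , v , det-uv≈1 , u≡u₀ , _ = liftUnimodular det-u₀v₀≈1
    in u , (v , S.1# , S.trans (S.*-identityʳ _) det-uv≈1) , u≡u₀

  liftGeo : (γ₀ : X₀.Geo) → Σ X.Geo λ γ → X₀.TEq (φT (X.Geo.tr γ)) (X₀.Geo.tr γ₀)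
  liftGeo (X₀.geo t₀ t₀∈𝒯 t₀⊨c) =
    let t , t∈𝒯 , φt≈t₀ = liftTri t₀ t₀∈𝒯
    in X.geo t t∈𝒯 (liftCondC t t∈𝒯 (Γ₀.CondC-TEq (Γ₀.TEq-sym φt≈t₀) t₀⊨c)) , φt≈t₀

  liftCondC-ρ : ∀ (γ : X.Geo) (γ₀ : X₀.Geo) → X₀.TEq (φT (X.Geo.tr γ)) (X₀.Geo.tr γ₀) →
                X₀.CondC (X₀.ρ (X₀.Geo.tr γ₀)) → X.CondC (X.ρ (X.Geo.tr γ))
  liftCondC-ρ γ γ₀ φγ≈γ₀ ργ₀⊨c = liftCondC (X.ρ t) (Γ.InT-ρ t (X.Geo.inT γ))
    (Γ₀.CondC-TEq (Γ₀.TEq-sym (Γ₀.TEq-trans (φT-ρ t) (Γ₀.ρ-cong φγ≈γ₀))) ργ₀⊨c)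
    where t = X.Geo.tr γ

  liftElliptic : ∀ (γ : X.Geo) (γ₀ : X₀.Geo) p₀ → X₀.TEq (φT (X.Geo.tr γ)) (X₀.Geo.tr γ₀) → X₀.Contains γ₀ p₀ → X.Ell
  liftElliptic γ γ₀ p₀ φγ≈γ₀ γ₀∋p₀ = Neg.ellipticAt γ (liftCondC-ρ γ γ₀ φγ≈γ₀ (Neg₀.Contains⇒CondC-ρ {γ₀} {p₀} γ₀∋p₀))

  liftElliptic-PEq : ∀ (γ : X.Geo) (γ₀ : X₀.Geo) p₀ (φγ≈γ₀ : X₀.TEq (φT (X.Geo.tr γ)) (X₀.Geo.tr γ₀))
                     (γ₀∋p₀ : X₀.Contains γ₀ p₀) → X₀.PEq L₀.I (φEll (liftElliptic γ γ₀ p₀ φγ≈γ₀ γ₀∋p₀)) p₀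
  liftElliptic-PEq γ γ₀ p₀ φγ≈γ₀ γ₀∋p₀ =
    Γ₀.PEq-contained {φGeo γ} {γ₀} {φEll (liftElliptic γ γ₀ p₀ φγ≈γ₀ γ₀∋p₀)} {p₀} L₀.I
      (φEll-Contains {γ} {liftElliptic γ γ₀ p₀ φγ≈γ₀ γ₀∋p₀} (inj₁ Γ.Orb-refl)) γ₀∋p₀
      (Γ₀.TEq⇒Orb (Γ₀.TEq-trans (Γ₀.actT-I (φT (X.Geo.tr γ))) φγ≈γ₀))

  liftOrbit : ∀ n {h₀} → G₀ h₀ → ∀ a b → X.InT a → X.InT b →
              X₀.TEq (iter X₀.ρ² n (X₀.actT h₀ (φT a))) (φT b) →
              Σ L.M λ m → G m × X.TEq (iter X.ρ² n (X.actT m a)) b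
  liftOrbit n {h₀} h₀∈G₀ a b a∈𝒯 b∈𝒯 h₀a≈b = via (liftG h₀∈G₀)
    where
    via : Σ L.M (λ h → G h × (φM h L₀.≈M h₀)) → Σ L.M λ m → G m × X.TEq (iter X.ρ² n (X.actT m a)) b
    via (h , h∈G , φh≈h₀) = k L.∙ h , G-∙ (InKernel⇒G k∈ker) h∈G , kha≈b
      where
      t : X.Tri
      t = iter X.ρ² n (X.actT h a)
      φt≈φb : X₀.TEq (φT t) (φT b)
      φt≈φb = Γ₀.TEq-trans (φT-iterρ² n (X.actT h a)) (Γ₀.TEq-trans (Γ₀.iterρ²-cong n (φT-actT h a))
                (Γ₀.TEq-trans (Γ₀.iterρ²-cong n (Γ₀.actT-congM (φT a) φh≈h₀)) h₀a≈b))
      transport : Σ L.M λ k → InKernel k × X.TEq (X.actT k t) b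
      transport = tripleTransport t b (Γ.InT-iterρ² n (X.actT h a) (Γ.InT-actT a (proj₁ h∈G) a∈𝒯)) b∈𝒯 φt≈φb
      k = proj₁ transport
      k∈ker = proj₁ (proj₂ transport)
      kha≈b : X.TEq (iter X.ρ² n (X.actT (k L.∙ h) a)) b
      kha≈b = Γ.TEq-trans (Γ.iterρ²-cong n (Γ.actT-∙ k h a))
                (Γ.TEq-trans (Γ.TEq-sym (Γ.actT-iterρ² n k (X.actT h a))) (proj₂ (proj₂ transport)))

  φV : X.VRep → X₀.VRep
  φV (inj₁ (u , u-parabolic)) = inj₁ (φU u , φU-IsParabolic u-parabolic)
  φV (inj₂ p)                 = inj₂ (φEll p)

  φE : X.ERep → X₀.ERep
  φE (inj₁ (γ , γ∌ell)) = inj₁ (φGeo γ , λ (p₀ , φγ∋p₀) → γ∌ell (liftElliptic γ (φGeo γ) p₀ Γ₀.TEq-refl φγ∋p₀ , inj₁ Γ.Orb-refl))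
  φE (inj₂ (X.half γ p γ∋p s)) = inj₂ (X₀.half (φGeo γ) (φEll p) (φEll-Contains {γ} {p} γ∋p) s)

  φV-kind : ∀ v → X₀.kindOf (φV v) ≡ X.kindOf v
  φV-kind (inj₁ _) = ≡.refl
  φV-kind (inj₂ _) = ≡.refl

  φE-weight : ∀ e → X₀.weightOf (φE e) ≡ X.weightOf e
  φE-weight (inj₁ _) = ≡.refl
  φE-weight (inj₂ _) = ≡.refl

  φV-cong : ∀ {u v} → X.VRel u v → X₀.VRel (φV u) (φV v)
  φV-cong {inj₁ (u , _)} {inj₁ _} (h , (_ , φh∈G₀) , hu≈±v) = φM h , φh∈G₀ , L₀.≈±-respˡ (φU-app h u) (φU-≈± hu≈±v)
  φV-cong {inj₂ p}       {inj₂ q} (h , (_ , φh∈G₀) , hp≈q)  = φM h , φh∈G₀ , φEll-PEq h {p} {q} hp≈q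

  φE-cong : ∀ {e e′} → X.ERel e e′ → X₀.ERel (φE e) (φE e′)
  φE-cong {inj₁ _} {inj₁ _} (h , (_ , φh∈G₀) , hγ~δ) = φM h , φh∈G₀ , φT-Orb-actT h hγ~δ
  φE-cong {inj₂ (X.half γ p _ _)} {inj₂ (X.half δ q _ _)} (h , (_ , φh∈G₀) , (n , hγ≈δ , s≡) , hp≈q) =
    φM h , φh∈G₀ ,
    (n , Γ₀.TEq-trans (Γ₀.TEq-sym (Γ₀.TEq-trans (φT-iterρ² n _) (Γ₀.iterρ²-cong n (φT-actT h (X.Geo.tr γ))))) (φT-TEq hγ≈δ) , s≡) ,
    φEll-PEq h {p} {q} hp≈q

  φV-inj : ∀ {u v} → X₀.VRel (φV u) (φV v) → X.VRel u v
  φV-inj {inj₁ (u , u-par)} {inj₁ (v , v-par)} (h₀ , h₀∈G₀ , h₀u≈±v) = via (liftG h₀∈G₀)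
    where
    via : Σ L.M (λ h → G h × (φM h L₀.≈M h₀)) → X.VRel (inj₁ (u , u-par)) (inj₁ (v , v-par))
    via (h , h∈G , φh≈h₀) with L₀.≈±-respˡ (L₀.≈U-sym (L₀.≈U-trans (φU-app h u) (L₀.app-cong φh≈h₀ L₀.≈U-refl))) h₀u≈±v
    ... | inj₁ hu≡v =
      let k , k∈ker , khu≈v = basisVectorTransport hu-basis (proj₁ v-par) hu≡v
      in k L.∙ h , G-∙ (InKernel⇒G k∈ker) h∈G , inj₁ (L.≈U-trans (L.app-∙ k h u) khu≈v)
      where hu-basis = Γ.IsBasisVector-app (proj₁ h∈G) (proj₁ u-par)
    ... | inj₂ hu≡-v =
      let k , k∈ker , khu≈-v = basisVectorTransport hu-basis (Γ.IsBasisVector-negU (proj₁ v-par))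
                                                      (L₀.≈U-trans hu≡-v (L₀.≈U-sym (φU-negU v)))
      in k L.∙ h , G-∙ (InKernel⇒G k∈ker) h∈G , inj₂ (L.≈U-trans (L.app-∙ k h u) khu≈-v)
      where hu-basis = Γ.IsBasisVector-app (proj₁ h∈G) (proj₁ u-par)
  φV-inj {inj₂ p@(X.ell a _ _)} {inj₂ q@(X.ell a′ _ _)} (h₀ , h₀∈G₀ , inj₁ ((n , h₀a≈a′) , _)) =
    let m , m∈G , ma≈a′ = liftOrbit n h₀∈G₀ (X.Geo.tr a) (X.Geo.tr a′) (X.Geo.inT a) (X.Geo.inT a′) h₀a≈a′
    in m , m∈G , Γ.PEq-contained {a} {a′} {p} {q} m (inj₁ Γ.Orb-refl) (inj₁ Γ.Orb-refl) (n , ma≈a′)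
  φV-inj {inj₂ p@(X.ell a _ _)} {inj₂ q@(X.ell _ b′ _)} (h₀ , h₀∈G₀ , inj₂ ((n , h₀a≈b′) , _)) =
    let m , m∈G , ma≈b′ = liftOrbit n h₀∈G₀ (X.Geo.tr a) (X.Geo.tr b′) (X.Geo.inT a) (X.Geo.inT b′) h₀a≈b′
    in m , m∈G , Γ.PEq-contained {a} {b′} {p} {q} m (inj₁ Γ.Orb-refl) (inj₂ Γ.Orb-refl) (n , ma≈b′)

  φE-inj : ∀ {e e′} → X₀.ERel (φE e) (φE e′) → X.ERel e e′
  φE-inj {inj₁ (γ , _)} {inj₁ (δ , _)} (h₀ , h₀∈G₀ , (n , h₀γ≈δ)) =
    let m , m∈G , mγ≈δ = liftOrbit n h₀∈G₀ (X.Geo.tr γ) (X.Geo.tr δ) (X.Geo.inT γ) (X.Geo.inT δ) h₀γ≈δ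
    in m , m∈G , (n , mγ≈δ)
  φE-inj {inj₂ (X.half γ p γ∋p _)} {inj₂ (X.half δ q δ∋q _)} (h₀ , h₀∈G₀ , (n , h₀γ≈δ , s≡) , _) =
    let m , m∈G , mγ≈δ = liftOrbit n h₀∈G₀ (X.Geo.tr γ) (X.Geo.tr δ) (X.Geo.inT γ) (X.Geo.inT δ) h₀γ≈δ
    in m , m∈G , (n , mγ≈δ , s≡) , Γ.PEq-contained {γ} {δ} {p} {q} m γ∋p δ∋q (n , mγ≈δ)

  φV-surj : ∀ v₀ → Σ X.VRep λ v → X₀.VRel (φV v) v₀
  φV-surj (inj₁ (u₀ , u₀-par)) =
    let u , u-basis , u≡u₀ = liftBasisVector (proj₁ u₀-par)
    in inj₁ (u , liftParabolic u-basis (Γ₀.IsParabolic-cong (L₀.≈U-sym u≡u₀) u₀-par)) ,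
       L₀.I , has-I , inj₁ (L₀.≈U-trans (L₀.app-I _) u≡u₀)
  φV-surj (inj₂ p₀@(X₀.ell a₀ _ _)) =
    let γ , φγ≈a₀ = liftGeo a₀
    in inj₂ (liftElliptic γ a₀ p₀ φγ≈a₀ (inj₁ Γ₀.Orb-refl)) ,
       L₀.I , has-I , liftElliptic-PEq γ a₀ p₀ φγ≈a₀ (inj₁ Γ₀.Orb-refl)

  I-Orb : ∀ (γ : X.Geo) (γ₀ : X₀.Geo) → X₀.TEq (φT (X.Geo.tr γ)) (X₀.Geo.tr γ₀) →
          X₀.Orb (X₀.actT L₀.I (φT (X.Geo.tr γ))) (X₀.Geo.tr γ₀)
  I-Orb γ γ₀ φγ≈γ₀ = Γ₀.TEq⇒Orb (Γ₀.TEq-trans (Γ₀.actT-I (φT (X.Geo.tr γ))) φγ≈γ₀)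

  liftNoElliptic : ∀ (γ : X.Geo) (γ₀ : X₀.Geo) → X₀.TEq (φT (X.Geo.tr γ)) (X₀.Geo.tr γ₀) →
                   ¬ Σ X₀.Ell (X₀.Contains γ₀) → ¬ Σ X.Ell (X.Contains γ)
  liftNoElliptic γ γ₀ φγ≈γ₀ γ₀∌ell (p , γ∋p) =
    γ₀∌ell (φEll p , Γ₀.Contains-TEq {φGeo γ} {γ₀} {φEll p} φγ≈γ₀ (φEll-Contains {γ} {p} γ∋p))

  φE-surj : ∀ e₀ → Σ X.ERep λ e → X₀.ERel (φE e) e₀
  φE-surj (inj₁ (γ₀ , γ₀∌ell)) =
    let γ , φγ≈γ₀ = liftGeo γ₀
    in inj₁ (γ , liftNoElliptic γ γ₀ φγ≈γ₀ γ₀∌ell) , L₀.I , has-I , I-Orb γ γ₀ φγ≈γ₀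
  φE-surj (inj₂ (X₀.half γ₀ p₀ γ₀∋p₀ s)) =
    let γ , φγ≈γ₀ = liftGeo γ₀
    in inj₂ (X.half γ (liftElliptic γ γ₀ p₀ φγ≈γ₀ γ₀∋p₀) (inj₁ Γ.Orb-refl) s) ,
       L₀.I , has-I , (0 , Γ₀.TEq-trans (Γ₀.actT-I _) φγ≈γ₀ , ≡.refl) , liftElliptic-PEq γ γ₀ p₀ φγ≈γ₀ γ₀∋p₀

  φE-IncT : ∀ e v → X.IncT e v → X₀.IncT (φE e) (φV v)
  φE-IncT (inj₁ _) (inj₁ _) (inj₁ u≈±x) = inj₁ (φU-≈± u≈±x)
  φE-IncT (inj₁ _) (inj₁ _) (inj₂ u≈±y) = inj₂ (φU-≈± u≈±y)
  φE-IncT (inj₂ (X.half γ _ _ s)) (inj₁ (u , _)) u≈±end =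
    ≡.subst (φU u L₀.≈±_) (≡.sym (φT-endpt (X.Geo.tr γ) s)) (φU-≈± u≈±end)
  φE-IncT (inj₂ (X.half _ p _ _)) (inj₂ q) p≈q =
    Γ₀.PEq-cong (φEll p) (φEll q) φM-I (φEll-PEq L.I {p} {q} p≈q)

  IncidentLift : X₀.ERep → X₀.VRep → Set _
  IncidentLift e₀ v₀ = Σ X.ERep λ e → Σ X.VRep λ v → X₀.ERel (φE e) e₀ × X₀.VRel (φV v) v₀ × X.IncT e v

  endpointLift : ∀ (γ : X.Geo) (γ₀ : X₀.Geo) s {u₀} (u₀-par : X₀.IsParabolic u₀) →
                 X₀.TEq (φT (X.Geo.tr γ)) (X₀.Geo.tr γ₀) → u₀ L₀.≈± X₀.endpt (X₀.Geo.tr γ₀) s →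
                 Σ (X.IsParabolic (X.endpt (X.Geo.tr γ) s)) λ end-par →
                   X₀.VRel (φV (inj₁ (X.endpt (X.Geo.tr γ) s , end-par))) (inj₁ (u₀ , u₀-par))
  endpointLift γ γ₀ s {u₀} u₀-par φγ≈γ₀ u₀≈±end₀ =
    liftParabolic (Γ.endpt-IsBasisVector t s (X.Geo.inT γ)) (Γ₀.IsParabolic-± u₀≈±φend u₀-par) ,
    L₀.I , has-I , L₀.≈±-respˡ (L₀.≈U-sym (L₀.app-I _)) (L₀.≈±-sym u₀≈±φend)
    where
    t = X.Geo.tr γ
    φend≈end₀ : φU (X.endpt t s) L₀.≈U X₀.endpt (X₀.Geo.tr γ₀) s
    φend≈end₀ = ≡.subst (L₀._≈U X₀.endpt (X₀.Geo.tr γ₀) s) (φT-endpt t s) (Γ₀.endpt-TEq {φT t} {X₀.Geo.tr γ₀} s φγ≈γ₀)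
    u₀≈±φend : u₀ L₀.≈± φU (X.endpt t s)
    u₀≈±φend = L₀.≈±-respʳ (L₀.≈U-sym φend≈end₀) u₀≈±end₀

  liftIncident : ∀ e₀ v₀ → X₀.IncT e₀ v₀ → IncidentLift e₀ v₀
  liftIncident (inj₁ (γ₀ , γ₀∌ell)) (inj₁ (u₀ , u₀-par)) u₀∈γ₀ = lift (liftGeo γ₀) u₀∈γ₀
    where
    lift : Σ X.Geo (λ γ → X₀.TEq (φT (X.Geo.tr γ)) (X₀.Geo.tr γ₀)) →
           X₀.IncT (inj₁ (γ₀ , γ₀∌ell)) (inj₁ (u₀ , u₀-par)) → IncidentLift (inj₁ (γ₀ , γ₀∌ell)) (inj₁ (u₀ , u₀-par))
    lift (γ , φγ≈γ₀) (inj₁ u₀≈±x₀) =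
      let x-par , φx~u₀ = endpointLift γ γ₀ true u₀-par φγ≈γ₀ u₀≈±x₀
      in inj₁ (γ , liftNoElliptic γ γ₀ φγ≈γ₀ γ₀∌ell) , inj₁ (_ , x-par) , (L₀.I , has-I , I-Orb γ γ₀ φγ≈γ₀) , φx~u₀ , inj₁ L.≈±-refl
    lift (γ , φγ≈γ₀) (inj₂ u₀≈±y₀) =
      let y-par , φy~u₀ = endpointLift γ γ₀ false u₀-par φγ≈γ₀ u₀≈±y₀
      in inj₁ (γ , liftNoElliptic γ γ₀ φγ≈γ₀ γ₀∌ell) , inj₁ (_ , y-par) , (L₀.I , has-I , I-Orb γ γ₀ φγ≈γ₀) , φy~u₀ , inj₂ L.≈±-refl
  liftIncident (inj₂ e₀@(X₀.half γ₀ p₀ γ₀∋p₀ s)) v₀ e₀∋v₀ = lift (liftGeo γ₀) v₀ e₀∋v₀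
    where
    lift : Σ X.Geo (λ γ → X₀.TEq (φT (X.Geo.tr γ)) (X₀.Geo.tr γ₀)) → ∀ v₀ → X₀.IncT (inj₂ e₀) v₀ → IncidentLift (inj₂ e₀) v₀
    lift (γ , φγ≈γ₀) v₀ e₀∋v₀ = incident v₀ e₀∋v₀
      where
      p = liftElliptic γ γ₀ p₀ φγ≈γ₀ γ₀∋p₀
      φp≈p₀ : X₀.PEq L₀.I (φEll p) p₀
      φp≈p₀ = liftElliptic-PEq γ γ₀ p₀ φγ≈γ₀ γ₀∋p₀
      e : X.ERep
      e = inj₂ (X.half γ p (inj₁ Γ.Orb-refl) s)
      φe~e₀ : X₀.ERel (φE e) (inj₂ e₀)
      φe~e₀ = L₀.I , has-I , (0 , Γ₀.TEq-trans (Γ₀.actT-I _) φγ≈γ₀ , ≡.refl) , φp≈p₀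
      incident : ∀ v₀ → X₀.IncT (inj₂ e₀) v₀ → IncidentLift (inj₂ e₀) v₀
      incident (inj₁ (u₀ , u₀-par)) u₀≈±end₀ =
        let end-par , φend~u₀ = endpointLift γ γ₀ s u₀-par φγ≈γ₀ u₀≈±end₀
        in e , inj₁ (_ , end-par) , φe~e₀ , φend~u₀ , L.≈±-refl
      incident (inj₂ q₀) p₀≈q₀ =
        e , inj₂ p , φe~e₀ ,
        (L₀.I , has-I , Γ₀.PEq-cong (φEll p) q₀ (L₀.∙-identityʳ L₀.I) (Γ₀.PEq-∙ L₀.I L₀.I {φEll p} {p₀} {q₀} φp≈p₀ p₀≈q₀)) ,
        Γ.PEq-refl p

  φ-Inc : ∀ e v → QGraph.Inc X.Ξ e v ⇔ QGraph.Inc X₀.Ξ (φE e) (φV v)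
  φ-Inc e v = mk⇔ to from
    where
    to : QGraph.Inc X.Ξ e v → QGraph.Inc X₀.Ξ (φE e) (φV v)
    to (e′ , v′ , e~e′ , v~v′ , e′∋v′) = φE e′ , φV v′ , φE-cong {e} {e′} e~e′ , φV-cong {v} {v′} v~v′ , φE-IncT e′ v′ e′∋v′
    from : QGraph.Inc X₀.Ξ (φE e) (φV v) → QGraph.Inc X.Ξ e v
    from (e₀ , v₀ , φe~e₀ , φv~v₀ , e₀∋v₀) =
      let e′ , v′ , φe′~e₀ , φv′~v₀ , e′∋v′ = liftIncident e₀ v₀ e₀∋v₀
      in e′ , v′ ,
         φE-inj {e} {e′} (Orbits₀.ERel-trans (φE e) e₀ (φE e′) φe~e₀ (Orbits₀.ERel-sym (φE e′) e₀ φe′~e₀)) ,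
         φV-inj {v} {v′} (Orbits₀.VRel-trans (φV v) v₀ (φV v′) φv~v₀ (Orbits₀.VRel-sym (φV v′) v₀ φv′~v₀)) ,
         e′∋v′

  Ξ≅Ξ₀ : XiGraph R α C G ≅ XiGraph R₀ (f α) (φM C) G₀
  Ξ≅Ξ₀ = record
    { fV = φV ; fV-cong = λ {u} {v} → φV-cong {u} {v} ; fV-inj = λ {u} {v} → φV-inj {u} {v}
    ; fV-surj = φV-surj ; fV-kind = φV-kind
    ; fE = φE ; fE-cong = λ {e} {e′} → φE-cong {e} {e′} ; fE-inj = λ {e} {e′} → φE-inj {e} {e′}
    ; fE-surj = φE-surj ; fE-wt = φE-weight
    ; fInc = φ-Inc
    }

theorem4p2 : ∀ {c₁ ℓ₁ c₂ ℓ₂ g}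
    (R : CommutativeRing c₁ ℓ₁) (R₀ : CommutativeRing c₂ ℓ₂)
    (f : CommutativeRing.Carrier R → CommutativeRing.Carrier R₀)
    → IsRingSurjection R R₀ f
    → ¬ (CommutativeRing._≈_ R₀ (LinAlg.three R₀) (CommutativeRing.0# R₀))
    → ¬ (CommutativeRing._≈_ R₀ (LinAlg.four R₀) (CommutativeRing.0# R₀))
    → SL₂-surjective R R₀ f
    → (α : CommutativeRing.Carrier R) → LinAlg.IsUnit R α
    → (C : LinAlg.M R)
    → LinAlg._≈M_ R (LinAlg._∙_ R C C) (LinAlg.I R)
    → CommutativeRing._≈_ R (LinAlg.detM R C) (CommutativeRing.-_ R (CommutativeRing.1# R))
    → (G₀ : LinAlg.M R₀ → Set g)
    → LinAlg.IsSubgroupOfSL R₀ G₀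
    → G₀ (LinAlg.negI R₀)
    → (∀ A → G₀ A → G₀ (LinAlg._∙_ R₀ (mapMat f C) (LinAlg._∙_ R₀ A (mapMat f C))))
    → (XiGraph R α C (preimage R R₀ f G₀)) ≅ (XiGraph R₀ (f α) (mapMat f C) G₀)
theorem4p2 R R₀ f f-surjection _ _ SL₂-surj α α-unit C C²≈I detC≈-1 G₀ G₀-subgroup G₀-negI _ =
  Lifting.Ξ≅Ξ₀ R R₀ f f-surjection SL₂-surj α α-unit C C²≈I detC≈-1 G₀ G₀-subgroup G₀-negI
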